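{- Let $N=(E,\mathcal{B})$ be a matroid of rank $r$. Then $\dim(D(\nu_N))\geq c(N)$.
   Context: $r_N$ is the rank function of $N$, and $\nu_N:\binom{E}{r}\to\mathbb{R}$ is given by $\nu_N(X):=r-r_N(X)$; it is a valuation of the uniform matroid $U(r,E)$, i.e. for all $B,B'\in\binom{E}{r}$ and $e\in B\setminus B'$ there is $f\in B'\setminus B$ with $\nu(B)+\nu(B')\geq\nu(B-e+f)+\nu(B'+e-f)$. $Z(r,E)$ is the set of triples $(S,ab,cd)$ with $S\in\binom{E}{r-2}$, $a,b,c,d\in E\setminus S$ distinct, $Sab:=S\cup\{a,b\}$ etc.; for a valuation $\nu$ of $U(r,E)$, $[\nu]:=\{(S,ab,cd)\in Z(r,E):\nu(Sac)+\nu(Sbd)=\nu(Sad)+\nu(Sbc)\}$, and $D(\nu):=\{\nu'\in\mathbb{R}^{\binom{E}{r}}:\nu'\text{ a valuation of }U(r,E)\text{ with }[\nu']=[\nu]\}$; $\dim D(\nu)$ is the dimension of its affine hull. The Johnson graph $J(r,E)$ has vertex set $\binom{E}{r}$, with $X,Y$ adjacent iff $|X\setminus Y|=1$. $c(N)$ is the number of connected components of the subgraph of $J(r,E)$ induced on the non-bases $\binom{E}{r}\setminus\mathcal{B}$. -}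

module Defs where

open import Data.Nat as ℕ using (ℕ; zero; suc; _⊔_)
open import Data.Bool using (Bool; true; false; if_then_else_)
open import Data.Fin using (Fin)
import Data.Fin as Fin
open import Data.Fin.Subset using (Subset; _∈_; _∉_; _∩_; _∪_; _-_; ⁅_⁆; ∣_∣; outside; inside)
open import Data.Vec using ([]; _∷_)
open import Data.List using (List; []; _∷_; _++_; map)
open import Data.Integer using (+_)
open import Data.Rational using (ℚ; 0ℚ; _+_; _*_; _/_; _≤_)
import Data.Rational as ℚ
open import Data.Product using (Σ; _×_; ∃; ∃-syntax; _,_)
open import Relation.Binary.PropositionalEquality using (_≡_; _≢_)
open import Function.Bundles using (_⇔_)
open import Relation.Nullary using (¬_)

exch : ∀ {n} → Subset n → Fin n → Fin n → Subset n
exch X e f = (X - e) ∪ ⁅ f ⁆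

allSubsets : (n : ℕ) → List (Subset n)
allSubsets zero    = [] ∷ []
allSubsets (suc n) = map (outside ∷_) (allSubsets n) ++ map (inside ∷_) (allSubsets n)

record Matroid (n : ℕ) : Set where
  field
    isBasis   : Subset n → Bool
    nonempty  : ∃[ B ] isBasis B ≡ true
    exchange  : ∀ B B' → isBasis B ≡ true → isBasis B' ≡ true →
                ∀ e → e ∈ B → e ∉ B' →
                ∃[ f ] (f ∈ B' × f ∉ B × isBasis (exch B e f) ≡ true)

open Matroid public

HasRank : ∀ {n} → Matroid n → ℕ → Set
HasRank N r = ∀ B → isBasis N B ≡ true → ∣ B ∣ ≡ r

maxList : List ℕ → ℕ
maxList []       = 0
maxList (x ∷ xs) = x ⊔ maxList xs

rankF : ∀ {n} → Matroid n → Subset n → ℕ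
rankF {n} N X = go (allSubsets n)
  where
  go : List (Subset n) → ℕ
  go []       = 0
  go (B ∷ Bs) = (if isBasis N B then ∣ X ∩ B ∣ else 0) ⊔ go Bs

fromℕ : ℕ → ℚ
fromℕ k = (+ k) / 1

νN : ∀ {n} → Matroid n → ℕ → Subset n → ℚ
νN N r X = fromℕ r ℚ.- fromℕ (rankF N X)

-- Functions ℚ^(E choose r): represented as Subset n → ℚ, only the values
-- on r-element subsets are relevant.

IsValuation : ∀ {n} → ℕ → (Subset n → ℚ) → Set
IsValuation {n} r ν =
  ∀ (B B' : Subset n) → ∣ B ∣ ≡ r → ∣ B' ∣ ≡ r →
  ∀ e → e ∈ B → e ∉ B' →
  ∃[ f ] (f ∈ B' × f ∉ B ×
          (ν (exch B e f) + ν (exch B' f e)) ≤ (ν B + ν B'))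

InZ : ∀ {n} → ℕ → Subset n → Fin n → Fin n → Fin n → Fin n → Set
InZ r S a b c d =
  (suc (suc ∣ S ∣) ≡ r) ×
  (a ∉ S × b ∉ S × c ∉ S × d ∉ S) ×
  (a ≢ b × a ≢ c × a ≢ d × b ≢ c × b ≢ d × c ≢ d)

_+₂_,_ : ∀ {n} → Subset n → Fin n → Fin n → Subset n
S +₂ x , y = (S ∪ ⁅ x ⁆) ∪ ⁅ y ⁆

InBracket : ∀ {n} → (Subset n → ℚ) → Subset n → Fin n → Fin n → Fin n → Fin n → Set
InBracket ν S a b c d = ν (S +₂ a , c) + ν (S +₂ b , d) ≡ ν (S +₂ a , d) + ν (S +₂ b , c)

SameBracket : ∀ {n} → ℕ → (Subset n → ℚ) → (Subset n → ℚ) → Set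
SameBracket {n} r ν ν' =
  ∀ (S : Subset n) a b c d → InZ r S a b c d →
  InBracket ν' S a b c d ⇔ InBracket ν S a b c d

InD : ∀ {n} → ℕ → (Subset n → ℚ) → (Subset n → ℚ) → Set
InD r ν ν' = IsValuation r ν' × SameBracket r ν ν'

-- Affine dimension: dim(aff D) ≥ k iff D contains k+1 affinely
-- independent points p₀,…,p_k, i.e. p₁-p₀,…,p_k-p₀ linearly independent
-- (as vectors indexed by the r-subsets of E).

sumFin : ∀ k → (Fin k → ℚ) → ℚ
sumFin zero    g = 0ℚ
sumFin (suc k) g = g Fin.zero + sumFin k (λ i → g (Fin.suc i))

AffinelyIndependent : ∀ {n} → ℕ → ∀ k → (Fin (suc k) → Subset n → ℚ) → Set
AffinelyIndependent {n} r k p =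
  ∀ (λs : Fin k → ℚ) →
  (∀ (X : Subset n) → ∣ X ∣ ≡ r →
     sumFin k (λ i → λs i * (p (Fin.suc i) X ℚ.- p Fin.zero X)) ≡ 0ℚ) →
  ∀ i → λs i ≡ 0ℚ

DimD≥ : ∀ {n} → ℕ → (Subset n → ℚ) → ℕ → Set
DimD≥ {n} r ν k =
  Σ (Fin (suc k) → Subset n → ℚ) λ p →
    (∀ i → InD r ν (p i)) × AffinelyIndependent r k p

NonBasis : ∀ {n} → Matroid n → ℕ → Subset n → Set
NonBasis N r X = ∣ X ∣ ≡ r × isBasis N X ≡ false

open import Data.Fin.Subset using (_─_)

Adjacent : ∀ {n} → Subset n → Subset n → Set
Adjacent X Y = ∣ X ─ Y ∣ ≡ 1

data Connected {n} (N : Matroid n) (r : ℕ) : Subset n → Subset n → Set where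
  here : ∀ {X} → NonBasis N r X → Connected N r X X
  step : ∀ {X Y Z} → NonBasis N r X → Adjacent X Y →
         Connected N r Y Z → Connected N r X Z

-- c(N) = k: there is a system of representatives R₁,…,R_k of the
-- connected components (pairwise in different components, and every
-- non-basis lies in the component of some Rᵢ).
NumComponents : ∀ {n} → Matroid n → ℕ → ℕ → Set
NumComponents {n} N r k =
  Σ (Fin k → Subset n) λ R →
    (∀ i → NonBasis N r (R i)) ×
    (∀ i j → Connected N r (R i) (R j) → i ≡ j) ×
    (∀ X → NonBasis N r X → ∃[ i ] Connected N r X (R i))

{-# OPTIONS --safe #-}
-- For each component C of the non-bases in the Johnson graph J(r,E), doubling ν_N on C gives
-- again a valuation with the same brackets as ν_N.  These c functions and ν_N itself are affinely
-- independent: on a representative of C only the one for C differs from ν_N, and ν_N is positive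
-- there.
--
-- A reweighting t·ν_N with t positive and constant on components keeps the brackets because the
-- four sets Sac, Sad, Sbd, Sbc form a 4-cycle of J(r,E): either one diagonal consists of bases,
-- so that side of the bracket equation is 0 and the other side vanishes for ν_N exactly when it
-- does for t·ν_N, or all non-bases among the four lie in one component and t is a common factor.
-- It stays a valuation by a strengthened exchange property of the rank function: for e ∈ B ∖ B′
-- there is f ∈ B′ ∖ B such that either neither exchange lowers the rank, or the rank sum does not
-- drop and all non-bases among B, B′, B - e + f, B′ - f + e lie in one component.  The latter is
-- proved by a case analysis on whether e and the elements of B′ ∖ B are spanned by B - e, using
-- submodularity, coloops, and the fact that two r-sets are joined through non-bases whenever
-- every r-set between them is a non-basis.
module Submission where

open import Defs
open import Data.Nat as ℕ using (ℕ; zero; suc; _+_; _*_; _∸_; _≤_; _<_; _⊔_; z≤n; s≤s; _≤?_; _<?_; NonZero)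
import Data.Nat.Properties as ℕ
open import Data.Nat.Coprimality as Coprime using (1-coprimeTo)
open import Algebra.Properties.CommutativeSemigroup ℕ.+-commutativeSemigroup using (interchange)
import Data.Integer as ℤ
import Data.Integer.Properties as ℤ
open import Data.Rational as ℚ using (ℚ; mkℚ; 0ℚ; 1ℚ; 1/_)
import Data.Rational.Properties as ℚ
open import Data.Bool as Bool using (Bool; true; false; if_then_else_)
open import Data.Fin as Fin using (Fin)
import Data.Fin.Properties as Fin
open import Data.Fin.Subset hiding (⊥)
open import Data.Fin.Subset.Properties
open import Data.Vec using ([]; _∷_; here; there; tabulate)
open import Data.Vec.Properties using (lookup⇒[]=; []=⇒lookup; lookup∘tabulate)
open import Data.List using (List; []; _∷_; map)
open import Data.List.Membership.Propositional using () renaming (_∈_ to _∈ₗ_)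
open import Data.List.Membership.Propositional.Properties using (∈-map⁺; ∈-++⁺ˡ; ∈-++⁺ʳ)
open import Data.List.Relation.Unary.Any using (here; there)
open import Data.Maybe using (Maybe; just; nothing)
open import Data.Product using (_×_; ∃-syntax; _,_; proj₁; proj₂)
import Data.Product as Product
open import Data.Sum using (_⊎_; inj₁; inj₂)
open import Data.Empty using (⊥; ⊥-elim)
open import Function using (_∘′_)
open import Function.Bundles using (_⇔_; mk⇔; Equivalence)
import Function.Properties.Equivalence as ⇔
open import Relation.Nullary using (¬_; ¬?; Dec; yes; no; does; contradiction)
open import Relation.Nullary.Decidable using (_×-dec_; decidable-stable)
open import Relation.Unary using (Pred; Decidable)
open import Relation.Binary.PropositionalEquality

private variable
  n : ℕ
  p q : Subset n
  x y : Fin n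

x∈p─q⁻ : ∀ (p q : Subset n) → x ∈ p ─ q → x ∈ p × x ∉ q
x∈p─q⁻ (inside ∷ p) (outside ∷ q) here       = here , λ ()
x∈p─q⁻ (_ ∷ p)      (outside ∷ q) (there x∈) = Product.map there (_∘′ drop-there) (x∈p─q⁻ p q x∈)
x∈p─q⁻ (_ ∷ p)      (inside ∷ q)  (there x∈) = Product.map there (_∘′ drop-there) (x∈p─q⁻ p q x∈)

x∈p-y⁻ : ∀ (p : Subset n) → x ∈ p - y → x ∈ p × x ≢ y
x∈p-y⁻ {y = y} p x∈ with x∈p─q⁻ p ⁅ y ⁆ x∈
... | x∈p , x∉⁅y⁆ = x∈p , x∉⁅y⁆⇒x≢y x∉⁅y⁆

x∉p∪⁅y⁆ : x ∉ p → x ≢ y → x ∉ p ∪ ⁅ y ⁆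
x∉p∪⁅y⁆ {p = p} {y = y} x∉p x≢y x∈ with x∈p∪q⁻ p ⁅ y ⁆ x∈
... | inj₁ x∈p = x∉p x∈p
... | inj₂ x∈y = x≢y (x∈⁅y⁆⇒x≡y y x∈y)

p-x∪⁅x⁆≡p : ∀ (p : Subset n) → x ∈ p → (p - x) ∪ ⁅ x ⁆ ≡ p
p-x∪⁅x⁆≡p {x = x} p x∈p = ⊆-antisym ⊆p p⊆
  where
  ⊆p : (p - x) ∪ ⁅ x ⁆ ⊆ p
  ⊆p z∈ with x∈p∪q⁻ (p - x) ⁅ x ⁆ z∈
  ... | inj₁ z∈p-x = proj₁ (x∈p-y⁻ p z∈p-x)
  ... | inj₂ z∈x rewrite x∈⁅y⁆⇒x≡y x z∈x = x∈p
  p⊆ : p ⊆ (p - x) ∪ ⁅ x ⁆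
  p⊆ {z} z∈p with z Fin.≟ x
  ... | yes refl = x∈p∪q⁺ (inj₂ (x∈⁅x⁆ x))
  ... | no z≢x   = x∈p∪q⁺ (inj₁ (x∈p∧x≢y⇒x∈p-y z∈p z≢x))

∈-exch⁻ : ∀ (p : Subset n) {a b} → x ∈ exch p a b → (x ∈ p × x ≢ a) ⊎ x ≡ b
∈-exch⁻ p {a} {b} x∈ with x∈p∪q⁻ (p - a) ⁅ b ⁆ x∈
... | inj₁ x∈p-a = inj₁ (x∈p-y⁻ p x∈p-a)
... | inj₂ x∈b   = inj₂ (x∈⁅y⁆⇒x≡y b x∈b)

∈-exch⁺ : ∀ {a b} → x ∈ p → x ≢ a → x ∈ exch p a b
∈-exch⁺ x∈p x≢a = x∈p∪q⁺ (inj₁ (x∈p∧x≢y⇒x∈p-y x∈p x≢a))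

b∈exch : ∀ (p : Subset n) a b → b ∈ exch p a b
b∈exch p a b = x∈p∪q⁺ (inj₂ (x∈⁅x⁆ b))

∩-⊆-∩exch : ∀ {a} b → a ∉ p → p ∩ q ⊆ p ∩ exch q a b
∩-⊆-∩exch {p = p} {q = q} _ a∉p x∈ with x∈p∩q⁻ p q x∈
... | x∈p , x∈q = x∈p∩q⁺ (x∈p , ∈-exch⁺ x∈q λ { refl → a∉p x∈p })

∩exch-⊆-∩ : ∀ a {b} → b ∉ p → p ∩ exch q a b ⊆ p ∩ q
∩exch-⊆-∩ {p = p} {q = q} a {b} b∉p x∈ with x∈p∩q⁻ p (exch q a b) x∈
... | x∈p , x∈exch with ∈-exch⁻ q x∈exch
...   | inj₁ (x∈q , _) = x∈p∩q⁺ (x∈p , x∈q)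
...   | inj₂ refl      = contradiction x∈p b∉p

∩-⊂-∩exch : ∀ {a b} → a ∉ p → b ∈ p → b ∉ q → p ∩ q ⊂ p ∩ exch q a b
∩-⊂-∩exch {p = p} {q = q} {b = b} a∉p b∈p b∉q =
  ∩-⊆-∩exch b a∉p , b , x∈p∩q⁺ (b∈p , b∈exch q _ b) , b∉q ∘′ proj₂ ∘′ x∈p∩q⁻ p q

exch-─-⊆ : ∀ {a b} → b ∈ q → exch p a b ─ q ⊆ (p ─ q) - a
exch-─-⊆ {q = q} {p = p} {a} {b} b∈q x∈ with x∈p─q⁻ (exch p a b) q x∈
... | x∈exch , x∉q with ∈-exch⁻ p x∈exch
...   | inj₁ (x∈p , x≢a) = x∈p∧x≢y⇒x∈p-y (x∈p∧x∉q⇒x∈p─q x∈p x∉q) x≢a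
...   | inj₂ refl        = contradiction b∈q x∉q

∣p∪⁅x⁆∣≡1+∣p∣ : ∀ (p : Subset n) → x ∉ p → ∣ p ∪ ⁅ x ⁆ ∣ ≡ suc ∣ p ∣
∣p∪⁅x⁆∣≡1+∣p∣ {x = Fin.zero}  (outside ∷ p) _   = cong suc (cong ∣_∣ (∪-identityʳ p))
∣p∪⁅x⁆∣≡1+∣p∣ {x = Fin.zero}  (inside ∷ p)  x∉p = contradiction here x∉p
∣p∪⁅x⁆∣≡1+∣p∣ {x = Fin.suc x} (outside ∷ p) x∉p = ∣p∪⁅x⁆∣≡1+∣p∣ p (x∉p ∘′ there)
∣p∪⁅x⁆∣≡1+∣p∣ {x = Fin.suc x} (inside ∷ p)  x∉p = cong suc (∣p∪⁅x⁆∣≡1+∣p∣ p (x∉p ∘′ there))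

∣p∣≡1+∣p-x∣ : ∀ (p : Subset n) → x ∈ p → ∣ p ∣ ≡ suc ∣ p - x ∣
∣p∣≡1+∣p-x∣ {x = Fin.zero}  (inside ∷ p)  here        = cong suc (cong ∣_∣ (sym (p─⊥≡p p)))
∣p∣≡1+∣p-x∣ {x = Fin.suc x} (outside ∷ p) (there x∈p) = ∣p∣≡1+∣p-x∣ p x∈p
∣p∣≡1+∣p-x∣ {x = Fin.suc x} (inside ∷ p)  (there x∈p) = cong suc (∣p∣≡1+∣p-x∣ p x∈p)

∣exch∣≡∣p∣ : ∀ (p : Subset n) {a b} → a ∈ p → b ∉ p → ∣ exch p a b ∣ ≡ ∣ p ∣
∣exch∣≡∣p∣ p {a} a∈p b∉p =
  trans (∣p∪⁅x⁆∣≡1+∣p∣ (p - a) (b∉p ∘′ proj₁ ∘′ x∈p-y⁻ p)) (sym (∣p∣≡1+∣p-x∣ p a∈p))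

∣p∣≡∣p∩q∣+∣p─q∣ : ∀ (p q : Subset n) → ∣ p ∣ ≡ ∣ p ∩ q ∣ + ∣ p ─ q ∣
∣p∣≡∣p∩q∣+∣p─q∣ []            []            = refl
∣p∣≡∣p∩q∣+∣p─q∣ (inside ∷ p)  (inside ∷ q)  = cong suc (∣p∣≡∣p∩q∣+∣p─q∣ p q)
∣p∣≡∣p∩q∣+∣p─q∣ (inside ∷ p)  (outside ∷ q) =
  trans (cong suc (∣p∣≡∣p∩q∣+∣p─q∣ p q)) (sym (ℕ.+-suc _ _))
∣p∣≡∣p∩q∣+∣p─q∣ (outside ∷ p) (inside ∷ q)  = ∣p∣≡∣p∩q∣+∣p─q∣ p q
∣p∣≡∣p∩q∣+∣p─q∣ (outside ∷ p) (outside ∷ q) = ∣p∣≡∣p∩q∣+∣p─q∣ p q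

∣p∪q∣+∣p∩q∣≡∣p∣+∣q∣ : ∀ (p q : Subset n) → ∣ p ∪ q ∣ + ∣ p ∩ q ∣ ≡ ∣ p ∣ + ∣ q ∣
∣p∪q∣+∣p∩q∣≡∣p∣+∣q∣ []            []            = refl
∣p∪q∣+∣p∩q∣≡∣p∣+∣q∣ (inside ∷ p)  (inside ∷ q)  =
  cong suc (trans (ℕ.+-suc _ _) (trans (cong suc (∣p∪q∣+∣p∩q∣≡∣p∣+∣q∣ p q)) (sym (ℕ.+-suc _ _))))
∣p∪q∣+∣p∩q∣≡∣p∣+∣q∣ (inside ∷ p)  (outside ∷ q) = cong suc (∣p∪q∣+∣p∩q∣≡∣p∣+∣q∣ p q)
∣p∪q∣+∣p∩q∣≡∣p∣+∣q∣ (outside ∷ p) (inside ∷ q)  =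
  trans (cong suc (∣p∪q∣+∣p∩q∣≡∣p∣+∣q∣ p q)) (sym (ℕ.+-suc _ _))
∣p∪q∣+∣p∩q∣≡∣p∣+∣q∣ (outside ∷ p) (outside ∷ q) = ∣p∪q∣+∣p∩q∣≡∣p∣+∣q∣ p q

∣p─q∣≡∣q─p∣ : ∀ (p q : Subset n) → ∣ p ∣ ≡ ∣ q ∣ → ∣ p ─ q ∣ ≡ ∣ q ─ p ∣
∣p─q∣≡∣q─p∣ p q ∣p∣≡∣q∣ = ℕ.+-cancelˡ-≡ ∣ p ∩ q ∣ _ _ (begin
  ∣ p ∩ q ∣ + ∣ p ─ q ∣  ≡⟨ ∣p∣≡∣p∩q∣+∣p─q∣ p q ⟨
  ∣ p ∣                  ≡⟨ ∣p∣≡∣q∣ ⟩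
  ∣ q ∣                  ≡⟨ ∣p∣≡∣p∩q∣+∣p─q∣ q p ⟩
  ∣ q ∩ p ∣ + ∣ q ─ p ∣  ≡⟨ cong (λ s → ∣ s ∣ + ∣ q ─ p ∣) (∩-comm q p) ⟩
  ∣ p ∩ q ∣ + ∣ q ─ p ∣  ∎)
  where open ≡-Reasoning

∣exch─q∣<∣p─q∣ : ∀ {a b} → a ∈ p → a ∉ q → b ∈ q → ∣ exch p a b ─ q ∣ < ∣ p ─ q ∣
∣exch─q∣<∣p─q∣ {p = p} {a = a} a∈p a∉q b∈q =
  ℕ.≤-<-trans (p⊆q⇒∣p∣≤∣q∣ (exch-─-⊆ {p = p} {a = a} b∈q))
              (x∈p⇒∣p-x∣<∣p∣ (x∈p∧x∉q⇒x∈p─q a∈p a∉q))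

p⊆q∧∣q∣≤∣p∣⇒p≡q : p ⊆ q → ∣ q ∣ ≤ ∣ p ∣ → p ≡ q
p⊆q∧∣q∣≤∣p∣⇒p≡q {p = []}          {[]}          _   _            = refl
p⊆q∧∣q∣≤∣p∣⇒p≡q {p = inside ∷ p}  {inside ∷ q}  p⊆q (s≤s ∣q∣≤∣p∣) =
  cong (inside ∷_) (p⊆q∧∣q∣≤∣p∣⇒p≡q (drop-∷-⊆ p⊆q) ∣q∣≤∣p∣)
p⊆q∧∣q∣≤∣p∣⇒p≡q {p = inside ∷ p}  {outside ∷ q} p⊆q _ with () ← p⊆q here
p⊆q∧∣q∣≤∣p∣⇒p≡q {p = outside ∷ p} {inside ∷ q}  p⊆q ∣q∣≤∣p∣ =
  contradiction (ℕ.≤-trans ∣q∣≤∣p∣ (p⊆q⇒∣p∣≤∣q∣ (drop-∷-⊆ p⊆q))) (ℕ.<-irrefl refl)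
p⊆q∧∣q∣≤∣p∣⇒p≡q {p = outside ∷ p} {outside ∷ q} p⊆q ∣q∣≤∣p∣ =
  cong (outside ∷_) (p⊆q∧∣q∣≤∣p∣⇒p≡q (drop-∷-⊆ p⊆q) ∣q∣≤∣p∣)

0<∣p∣⇒Nonempty : ∀ (p : Subset n) → 0 < ∣ p ∣ → Nonempty p
0<∣p∣⇒Nonempty (inside ∷ p)  _     = Fin.zero , here
0<∣p∣⇒Nonempty (outside ∷ p) 0<∣p∣ with 0<∣p∣⇒Nonempty p 0<∣p∣
... | x , x∈p = Fin.suc x , there x∈p

x∈p⇒0<∣p∣ : x ∈ p → 0 < ∣ p ∣
x∈p⇒0<∣p∣ x∈p = ℕ.≤-<-trans z≤n (x∈p⇒∣p-x∣<∣p∣ x∈p)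

search : ∀ {ℓ} {P : Pred (Fin n) ℓ} → Decidable P → (p : Subset n) →
         (∃[ x ] (x ∈ p × P x)) ⊎ (∀ {x} → x ∈ p → ¬ P x)
search P? p with Fin.any? (λ x → (x ∈? p) ×-dec P? x)
... | yes (x , x∈p , Px) = inj₁ (x , x∈p , Px)
... | no ∄x              = inj₂ λ x∈p Px → ∄x (_ , x∈p , Px)

⊆⊎∃∉ : ∀ (p q : Subset n) → p ⊆ q ⊎ ∃[ x ] (x ∈ p × x ∉ q)
⊆⊎∃∉ p q with search (λ x → ¬? (x ∈? q)) p
... | inj₁ x∈p─q = inj₂ x∈p─q
... | inj₂ p⊆q   = inj₁ λ {x} x∈p → decidable-stable (x ∈? q) (p⊆q x∈p)

∸-exchange : ∀ {r a b c d} → a ≤ r → b ≤ r → c ≤ r → d ≤ r →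
             a + b ≤ c + d → (r ∸ c) + (r ∸ d) ≤ (r ∸ a) + (r ∸ b)
∸-exchange {r} {a} {b} {c} {d} a≤r b≤r c≤r d≤r a+b≤c+d = ℕ.+-cancelʳ-≤ (a + b) _ _ (begin
  (r ∸ c) + (r ∸ d) + (a + b)  ≤⟨ ℕ.+-monoʳ-≤ ((r ∸ c) + (r ∸ d)) a+b≤c+d ⟩
  (r ∸ c) + (r ∸ d) + (c + d)  ≡⟨ complements c≤r d≤r ⟩
  r + r                        ≡⟨ complements a≤r b≤r ⟨
  (r ∸ a) + (r ∸ b) + (a + b)  ∎)
  where
  open ℕ.≤-Reasoning
  complements : ∀ {x y} → x ≤ r → y ≤ r → (r ∸ x) + (r ∸ y) + (x + y) ≡ r + r
  complements {x} {y} x≤r y≤r =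
    trans (interchange (r ∸ x) (r ∸ y) x y) (cong₂ _+_ (ℕ.m∸n+n≡m x≤r) (ℕ.m∸n+n≡m y≤r))

private
  fromℕ≡mkℚ : ∀ k → fromℕ k ≡ mkℚ (ℤ.+ k) 0 (Coprime.sym (1-coprimeTo k))
  fromℕ≡mkℚ k = ℚ.↥p/↧p≡p (mkℚ (ℤ.+ k) 0 (Coprime.sym (1-coprimeTo k)))

fromℕ-+ : ∀ a b → fromℕ (a + b) ≡ fromℕ a ℚ.+ fromℕ b
fromℕ-+ a b rewrite fromℕ≡mkℚ a | fromℕ≡mkℚ b =
  sym (cong₂ (λ u v → (u ℤ.+ v) ℚ./ 1) (ℤ.*-identityʳ (ℤ.+ a)) (ℤ.*-identityʳ (ℤ.+ b)))

fromℕ-mono-≤ : ∀ {a b} → a ≤ b → fromℕ a ℚ.≤ fromℕ b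
fromℕ-mono-≤ {a} {b} a≤b rewrite fromℕ≡mkℚ a | fromℕ≡mkℚ b =
  ℚ.*≤* (subst₂ ℤ._≤_ (sym (ℤ.*-identityʳ (ℤ.+ a))) (sym (ℤ.*-identityʳ (ℤ.+ b))) (ℤ.+≤+ a≤b))

fromℕ-injective : ∀ {a b} → fromℕ a ≡ fromℕ b → a ≡ b
fromℕ-injective {a} {b} eq = ℤ.+-injective (begin
  ℤ.+ a            ≡⟨ cong ℚ.↥_ (fromℕ≡mkℚ a) ⟨
  ℚ.↥ (fromℕ a)    ≡⟨ cong ℚ.↥_ eq ⟩
  ℚ.↥ (fromℕ b)    ≡⟨ cong ℚ.↥_ (fromℕ≡mkℚ b) ⟩
  ℤ.+ b            ∎)
  where open ≡-Reasoning

fromℕ-+-cancelˡ : ∀ a b → fromℕ (a + b) ℚ.- fromℕ a ≡ fromℕ b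
fromℕ-+-cancelˡ a b = begin
  fromℕ (a + b) ℚ.- fromℕ a              ≡⟨ cong (ℚ._- fromℕ a) (fromℕ-+ a b) ⟩
  (fromℕ a ℚ.+ fromℕ b) ℚ.- fromℕ a      ≡⟨ cong (ℚ._- fromℕ a) (ℚ.+-comm (fromℕ a) (fromℕ b)) ⟩
  (fromℕ b ℚ.+ fromℕ a) ℚ.- fromℕ a      ≡⟨ ℚ.+-assoc (fromℕ b) (fromℕ a) (ℚ.- fromℕ a) ⟩
  fromℕ b ℚ.+ (fromℕ a ℚ.- fromℕ a)      ≡⟨ cong (fromℕ b ℚ.+_) (ℚ.+-inverseʳ (fromℕ a)) ⟩
  fromℕ b ℚ.+ 0ℚ                         ≡⟨ ℚ.+-identityʳ (fromℕ b) ⟩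
  fromℕ b                                ∎
  where open ≡-Reasoning

fromℕ-∸ : ∀ {a b} → b ≤ a → fromℕ a ℚ.- fromℕ b ≡ fromℕ (a ∸ b)
fromℕ-∸ {a} {b} b≤a =
  trans (cong (λ c → fromℕ c ℚ.- fromℕ b) (sym (ℕ.m+[n∸m]≡n b≤a))) (fromℕ-+-cancelˡ b (a ∸ b))

fromℕ-sum-≡⇔ : ∀ a b c d → (fromℕ a ℚ.+ fromℕ b ≡ fromℕ c ℚ.+ fromℕ d) ⇔ (a + b ≡ c + d)
fromℕ-sum-≡⇔ a b c d = mk⇔
  (λ eq → fromℕ-injective (trans (fromℕ-+ a b) (trans eq (sym (fromℕ-+ c d)))))
  (λ eq → trans (sym (fromℕ-+ a b)) (trans (cong fromℕ eq) (fromℕ-+ c d)))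

*-fromℕ≡0 : ∀ x k → 0 < k → x ℚ.* fromℕ k ≡ 0ℚ → x ≡ 0ℚ
*-fromℕ≡0 x (suc m) _ eq rewrite fromℕ≡mkℚ (suc m) = begin
  x                    ≡⟨ ℚ.*-identityʳ x ⟨
  x ℚ.* 1ℚ             ≡⟨ cong (x ℚ.*_) (ℚ.*-inverseʳ k) ⟨
  x ℚ.* (k ℚ.* 1/ k)   ≡⟨ ℚ.*-assoc x k (1/ k) ⟨
  (x ℚ.* k) ℚ.* 1/ k   ≡⟨ cong (ℚ._* 1/ k) eq ⟩
  0ℚ ℚ.* 1/ k          ≡⟨ ℚ.*-zeroˡ (1/ k) ⟩
  0ℚ                   ∎
  where
  open ≡-Reasoning
  k = mkℚ (ℤ.+ suc m) 0 (Coprime.sym (1-coprimeTo (suc m)))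

sumFin-zero : ∀ k (g : Fin k → ℚ) → (∀ i → g i ≡ 0ℚ) → sumFin k g ≡ 0ℚ
sumFin-zero zero    g vanish = refl
sumFin-zero (suc k) g vanish =
  trans (cong₂ ℚ._+_ (vanish Fin.zero) (sumFin-zero k (g ∘′ Fin.suc) (λ i → vanish (Fin.suc i)))) (ℚ.+-identityʳ 0ℚ)

sumFin-single : ∀ k (g : Fin k → ℚ) i → (∀ j → j ≢ i → g j ≡ 0ℚ) → sumFin k g ≡ g i
sumFin-single (suc k) g Fin.zero vanish =
  trans (cong (g Fin.zero ℚ.+_) (sumFin-zero k (g ∘′ Fin.suc) (λ j → vanish (Fin.suc j) λ ()))) (ℚ.+-identityʳ (g Fin.zero))
sumFin-single (suc k) g (Fin.suc i) vanish =
  trans (cong₂ ℚ._+_ (vanish Fin.zero λ ()) (sumFin-single k (g ∘′ Fin.suc) i vanish-suc)) (ℚ.+-identityˡ (g (Fin.suc i)))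
  where
  vanish-suc : ∀ j → j ≢ i → g (Fin.suc j) ≡ 0ℚ
  vanish-suc j j≢i = vanish (Fin.suc j) (j≢i ∘′ Fin.suc-injective)

InBracket-cong : ∀ {ν ν′ : Subset n → ℚ} → (∀ X → ν X ≡ ν′ X) →
                 ∀ S a b c d → InBracket ν S a b c d ⇔ InBracket ν′ S a b c d
InBracket-cong ν≗ν′ S a b c d = mk⇔
  (λ eq → trans (sym (cong₂ ℚ._+_ (ν≗ν′ _) (ν≗ν′ _))) (trans eq (cong₂ ℚ._+_ (ν≗ν′ _) (ν≗ν′ _))))
  (λ eq → trans (cong₂ ℚ._+_ (ν≗ν′ _) (ν≗ν′ _)) (trans eq (sym (cong₂ ℚ._+_ (ν≗ν′ _) (ν≗ν′ _)))))

Balanced : (P Q : Bool → Subset n) → (Subset n → ℕ) → Set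
Balanced P Q f = f (P false) + f (P true) ≡ f (Q false) + f (Q true)

-- The Johnson graph

Adjacent-∪⁅⁆ : ∀ {X : Subset n} → x ∉ X → x ≢ y → Adjacent (X ∪ ⁅ x ⁆) (X ∪ ⁅ y ⁆)
Adjacent-∪⁅⁆ {x = x} {y} {X} x∉X x≢y = trans (cong ∣_∣ (⊆-antisym ⊆⁅x⁆ ⁅x⁆⊆)) (∣⁅x⁆∣≡1 x)
  where
  ⊆⁅x⁆ : (X ∪ ⁅ x ⁆) ─ (X ∪ ⁅ y ⁆) ⊆ ⁅ x ⁆
  ⊆⁅x⁆ z∈ with x∈p─q⁻ (X ∪ ⁅ x ⁆) (X ∪ ⁅ y ⁆) z∈
  ... | z∈X∪x , z∉X∪y with x∈p∪q⁻ X ⁅ x ⁆ z∈X∪x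
  ...   | inj₁ z∈X = contradiction (x∈p∪q⁺ (inj₁ z∈X)) z∉X∪y
  ...   | inj₂ z∈x = z∈x
  ⁅x⁆⊆ : ⁅ x ⁆ ⊆ (X ∪ ⁅ x ⁆) ─ (X ∪ ⁅ y ⁆)
  ⁅x⁆⊆ z∈ rewrite x∈⁅y⁆⇒x≡y x z∈ =
    x∈p∧x∉q⇒x∈p─q (x∈p∪q⁺ (inj₂ (x∈⁅x⁆ x))) (x∉p∪⁅y⁆ x∉X x≢y)

Adjacent-exch : ∀ {X : Subset n} → x ∈ X → y ∉ X → Adjacent X (exch X x y)
Adjacent-exch {x = x} {y} {X} x∈X y∉X =
  subst (λ S → Adjacent S (exch X x y)) (p-x∪⁅x⁆≡p X x∈X)
        (Adjacent-∪⁅⁆ (λ x∈ → proj₂ (x∈p-y⁻ X x∈) refl) (λ { refl → y∉X x∈X }))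

exch-Adjacent : ∀ {X : Subset n} → x ∈ X → y ∉ X → Adjacent (exch X x y) X
exch-Adjacent {x = x} {y} {X} x∈X y∉X =
  subst (Adjacent (exch X x y)) (p-x∪⁅x⁆≡p X x∈X)
        (Adjacent-∪⁅⁆ (y∉X ∘′ proj₁ ∘′ x∈p-y⁻ X) (λ { refl → y∉X x∈X }))

Adjacent-sym : ∀ {X Y : Subset n} → ∣ X ∣ ≡ ∣ Y ∣ → Adjacent X Y → Adjacent Y X
Adjacent-sym {X = X} {Y} ∣X∣≡∣Y∣ adj = trans (sym (∣p─q∣≡∣q─p∣ X Y ∣X∣≡∣Y∣)) adj

∣+₂∣≡2+∣S∣ : ∀ {S : Subset n} → x ∉ S → y ∉ S → x ≢ y → ∣ S +₂ x , y ∣ ≡ suc (suc ∣ S ∣)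
∣+₂∣≡2+∣S∣ {x = x} {S = S} x∉S y∉S x≢y =
  trans (∣p∪⁅x⁆∣≡1+∣p∣ (S ∪ ⁅ x ⁆) (x∉p∪⁅y⁆ y∉S (x≢y ∘′ sym)))
        (cong suc (∣p∪⁅x⁆∣≡1+∣p∣ S x∉S))

+₂-comm : ∀ (S : Subset n) x y → S +₂ x , y ≡ S +₂ y , x
+₂-comm S x y = begin
  (S ∪ ⁅ x ⁆) ∪ ⁅ y ⁆  ≡⟨ ∪-assoc S ⁅ x ⁆ ⁅ y ⁆ ⟩
  S ∪ (⁅ x ⁆ ∪ ⁅ y ⁆)  ≡⟨ cong (S ∪_) (∪-comm ⁅ x ⁆ ⁅ y ⁆) ⟩
  S ∪ (⁅ y ⁆ ∪ ⁅ x ⁆)  ≡⟨ ∪-assoc S ⁅ y ⁆ ⁅ x ⁆ ⟨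
  (S ∪ ⁅ y ⁆) ∪ ⁅ x ⁆  ∎
  where open ≡-Reasoning

Adjacent-+₂ : ∀ {S : Subset n} {x y z} → y ∉ S → y ≢ x → y ≢ z → Adjacent (S +₂ x , y) (S +₂ x , z)
Adjacent-+₂ y∉S y≢x y≢z = Adjacent-∪⁅⁆ (x∉p∪⁅y⁆ y∉S y≢x) y≢z

module _ (N : Matroid n) {r : ℕ} where

  private
    _~_ = Connected N r

  Connected⇒NonBasisˡ : ∀ {X Y} → X ~ Y → NonBasis N r X
  Connected⇒NonBasisˡ (here X-nb)     = X-nb
  Connected⇒NonBasisˡ (step X-nb _ _) = X-nb

  Connected⇒NonBasisʳ : ∀ {X Y} → X ~ Y → NonBasis N r Y
  Connected⇒NonBasisʳ (here Y-nb)  = Y-nb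
  Connected⇒NonBasisʳ (step _ _ c) = Connected⇒NonBasisʳ c

  Connected-trans : ∀ {X Y Z} → X ~ Y → Y ~ Z → X ~ Z
  Connected-trans (here _)           Y~Z = Y~Z
  Connected-trans (step X-nb adj X~) Y~Z = step X-nb adj (Connected-trans X~ Y~Z)

  Connected-sym : ∀ {X Y} → X ~ Y → Y ~ X
  Connected-sym (here X-nb) = here X-nb
  Connected-sym (step {X} {X′} X-nb adj X′~Y) =
    Connected-trans (Connected-sym X′~Y)
      (step X′-nb (Adjacent-sym {X = X} (trans (proj₁ X-nb) (sym (proj₁ X′-nb))) adj) (here X-nb))
    where X′-nb = Connected⇒NonBasisˡ X′~Y

  private
    interval-by : ∀ d {X Y} → ∣ X ─ Y ∣ < d → ∣ X ∣ ≡ r → ∣ Y ∣ ≡ r →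
                  (∀ {Z} → ∣ Z ∣ ≡ r → X ∩ Y ⊆ Z → Z ⊆ X ∪ Y → isBasis N Z ≡ false) → X ~ Y
    interval-by (suc d) {X} {Y} ∣X─Y∣<1+d ∣X∣≡r ∣Y∣≡r nonbases with nonempty? (X ─ Y)
    ... | no X─Y-empty = subst (X ~_) X≡Y (here X-nb)
      where
      X-nb : NonBasis N r X
      X-nb = ∣X∣≡r , nonbases ∣X∣≡r (p∩q⊆p X Y) (p⊆p∪q Y)
      X⊆Y : X ⊆ Y
      X⊆Y {z} z∈X with z ∈? Y
      ... | yes z∈Y = z∈Y
      ... | no z∉Y  = contradiction (z , x∈p∧x∉q⇒x∈p─q z∈X z∉Y) X─Y-empty
      X≡Y : X ≡ Y
      X≡Y = p⊆q∧∣q∣≤∣p∣⇒p≡q X⊆Y (ℕ.≤-reflexive (trans ∣Y∣≡r (sym ∣X∣≡r)))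
    ... | yes (x , x∈X─Y)
      with 0<∣p∣⇒Nonempty (Y ─ X)
             (subst (0 <_) (∣p─q∣≡∣q─p∣ X Y (trans ∣X∣≡r (sym ∣Y∣≡r))) (x∈p⇒0<∣p∣ x∈X─Y))
    ... | y , y∈Y─X =
      step (∣X∣≡r , nonbases ∣X∣≡r (p∩q⊆p X Y) (p⊆p∪q Y)) (Adjacent-exch x∈X y∉X)
           (interval-by d (ℕ.<-≤-trans (∣exch─q∣<∣p─q∣ x∈X x∉Y y∈Y) (ℕ.s≤s⁻¹ ∣X─Y∣<1+d))
                        (trans (∣exch∣≡∣p∣ X x∈X y∉X) ∣X∣≡r) ∣Y∣≡r
                        (λ ∣Z∣≡r ⊆Z Z⊆ → nonbases ∣Z∣≡r (⊆Z ∘′ X∩Y⊆) (X′∪Y⊆ ∘′ Z⊆)))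
      where
      x∈X = proj₁ (x∈p─q⁻ X Y x∈X─Y)
      x∉Y = proj₂ (x∈p─q⁻ X Y x∈X─Y)
      y∈Y = proj₁ (x∈p─q⁻ Y X y∈Y─X)
      y∉X = proj₂ (x∈p─q⁻ Y X y∈Y─X)
      X∩Y⊆ : X ∩ Y ⊆ exch X x y ∩ Y
      X∩Y⊆ z∈ with x∈p∩q⁻ X Y z∈
      ... | z∈X , z∈Y = x∈p∩q⁺ (∈-exch⁺ z∈X (λ { refl → x∉Y z∈Y }) , z∈Y)
      X′∪Y⊆ : exch X x y ∪ Y ⊆ X ∪ Y
      X′∪Y⊆ z∈ with x∈p∪q⁻ (exch X x y) Y z∈
      ... | inj₂ z∈Y = x∈p∪q⁺ (inj₂ z∈Y)
      ... | inj₁ z∈X′ with ∈-exch⁻ X z∈X′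
      ...   | inj₁ (z∈X , _) = x∈p∪q⁺ (inj₁ z∈X)
      ...   | inj₂ refl      = x∈p∪q⁺ (inj₂ y∈Y)

  interval : ∀ {X Y} → ∣ X ∣ ≡ r → ∣ Y ∣ ≡ r →
             (∀ {Z} → ∣ Z ∣ ≡ r → X ∩ Y ⊆ Z → Z ⊆ X ∪ Y → isBasis N Z ≡ false) → X ~ Y
  interval {X} {Y} = interval-by (suc ∣ X ─ Y ∣) (ℕ.n<1+n _)

-- The rank function

∈-allSubsets : ∀ (X : Subset n) → X ∈ₗ allSubsets n
∈-allSubsets []                   = here refl
∈-allSubsets (outside ∷ X)        = ∈-++⁺ˡ (∈-map⁺ (outside ∷_) (∈-allSubsets X))
∈-allSubsets {suc n} (inside ∷ X) = ∈-++⁺ʳ (map (outside ∷_) (allSubsets n)) (∈-map⁺ (inside ∷_) (∈-allSubsets X))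

module _ (N : Matroid n) where

  private
    rk = rankF N

    rankOver : Subset n → List (Subset n) → ℕ
    rankOver X []       = 0
    rankOver X (B ∷ Bs) = (if isBasis N B then ∣ X ∩ B ∣ else 0) ⊔ rankOver X Bs

    list-ind : ∀ {A : Set} (P : List A → Set) → P [] → (∀ x xs → P xs → P (x ∷ xs)) → ∀ xs → P xs
    list-ind P nil cons []       = nil
    list-ind P nil cons (x ∷ xs) = cons x xs (list-ind P nil cons xs)

    -- rankF folds with a function local to a where block; it can only be reached by abstracting
    -- over the list it is applied to.
    rankF≡rankOver : ∀ X → rk X ≡ rankOver X (allSubsets n)
    rankF≡rankOver X with allSubsets n | list-ind {A = Subset n} _
    ... | Bs | ind = ind refl (λ B _ eq → cong ((if isBasis N B then ∣ X ∩ B ∣ else 0) ⊔_) eq) Bs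

    ≤-rankOver : ∀ X {B} Bs → B ∈ₗ Bs → isBasis N B ≡ true → ∣ X ∩ B ∣ ≤ rankOver X Bs
    ≤-rankOver X (B ∷ Bs) (here refl) B-basis rewrite B-basis = ℕ.m≤m⊔n _ _
    ≤-rankOver X (_ ∷ Bs) (there B∈) B-basis = ℕ.≤-trans (≤-rankOver X Bs B∈ B-basis) (ℕ.m≤n⊔m _ _)

    rankOver-attained : ∀ X Bs → rankOver X Bs ≡ 0 ⊎ ∃[ B ] (isBasis N B ≡ true × rankOver X Bs ≡ ∣ X ∩ B ∣)
    rankOver-attained X []       = inj₁ refl
    rankOver-attained X (B ∷ Bs) with isBasis N B in B-basis | ℕ.⊔-sel ∣ X ∩ B ∣ (rankOver X Bs)
    ... | true  | inj₁ eq = inj₂ (B , B-basis , eq)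
    ... | true  | inj₂ eq with rankOver-attained X Bs
    ...   | inj₁ eq₀                   = inj₁ (trans eq eq₀)
    ...   | inj₂ (B′ , B′-basis , eq′) = inj₂ (B′ , B′-basis , trans eq eq′)
    rankOver-attained X (B ∷ Bs) | false | _ = rankOver-attained X Bs

  ∣X∩B∣≤rankF : ∀ X {B} → isBasis N B ≡ true → ∣ X ∩ B ∣ ≤ rk X
  ∣X∩B∣≤rankF X {B} B-basis =
    subst (∣ X ∩ B ∣ ≤_) (sym (rankF≡rankOver X)) (≤-rankOver X _ (∈-allSubsets B) B-basis)

  rankF-attained : ∀ X → ∃[ B ] (isBasis N B ≡ true × rk X ≡ ∣ X ∩ B ∣)
  rankF-attained X with rankOver-attained X (allSubsets n)
  ... | inj₂ (B , B-basis , eq) = B , B-basis , trans (rankF≡rankOver X) eq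
  ... | inj₁ eq₀ with nonempty N
  ...   | B , B-basis = B , B-basis , ℕ.≤-antisym (ℕ.≤-trans (ℕ.≤-reflexive (trans (rankF≡rankOver X) eq₀)) z≤n)
                                                  (∣X∩B∣≤rankF X B-basis)

  rankF-mono : ∀ {X Y} → X ⊆ Y → rk X ≤ rk Y
  rankF-mono {X} {Y} X⊆Y with rankF-attained X
  ... | B , B-basis , eq = begin
    rk X       ≡⟨ eq ⟩
    ∣ X ∩ B ∣  ≤⟨ p⊆q⇒∣p∣≤∣q∣ X∩B⊆Y∩B ⟩
    ∣ Y ∩ B ∣  ≤⟨ ∣X∩B∣≤rankF Y B-basis ⟩
    rk Y       ∎
    where
    open ℕ.≤-Reasoning
    X∩B⊆Y∩B : X ∩ B ⊆ Y ∩ B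
    X∩B⊆Y∩B z∈ with x∈p∩q⁻ X B z∈
    ... | z∈X , z∈B = x∈p∩q⁺ (X⊆Y z∈X , z∈B)

  rankF≤∣X∣ : ∀ X → rk X ≤ ∣ X ∣
  rankF≤∣X∣ X with rankF-attained X
  ... | B , _ , eq = ℕ.≤-trans (ℕ.≤-reflexive eq) (∣p∩q∣≤∣p∣ X B)

  module _ {r} (hasRank : HasRank N r) where

    rankF≤r : ∀ X → rk X ≤ r
    rankF≤r X with rankF-attained X
    ... | B , B-basis , eq = begin
      rk X       ≡⟨ eq ⟩
      ∣ X ∩ B ∣  ≤⟨ ∣p∩q∣≤∣q∣ X B ⟩
      ∣ B ∣      ≡⟨ hasRank B B-basis ⟩
      r          ∎
      where open ℕ.≤-Reasoning

    basis⇒r≤rankF : ∀ {B} → isBasis N B ≡ true → r ≤ rk B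
    basis⇒r≤rankF {B} B-basis =
      subst (_≤ rk B) (trans (cong ∣_∣ (∩-idem B)) (hasRank B B-basis)) (∣X∩B∣≤rankF B B-basis)

    r≤rankF⇒basis : ∀ {X} → ∣ X ∣ ≡ r → r ≤ rk X → isBasis N X ≡ true
    r≤rankF⇒basis {X} ∣X∣≡r r≤rk with rankF-attained X
    ... | B , B-basis , eq = subst (λ S → isBasis N S ≡ true) (trans (sym X∩B≡B) X∩B≡X) B-basis
      where
      r≤∣X∩B∣ : r ≤ ∣ X ∩ B ∣
      r≤∣X∩B∣ = ℕ.≤-trans r≤rk (ℕ.≤-reflexive eq)
      X∩B≡X : X ∩ B ≡ X
      X∩B≡X = p⊆q∧∣q∣≤∣p∣⇒p≡q (p∩q⊆p X B) (subst (_≤ ∣ X ∩ B ∣) (sym ∣X∣≡r) r≤∣X∩B∣)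
      X∩B≡B : X ∩ B ≡ B
      X∩B≡B = p⊆q∧∣q∣≤∣p∣⇒p≡q (p∩q⊆q X B) (subst (_≤ ∣ X ∩ B ∣) (sym (hasRank B B-basis)) r≤∣X∩B∣)

    nonbasis⇒rankF<r : ∀ {X} → NonBasis N r X → rk X < r
    nonbasis⇒rankF<r {X} (∣X∣≡r , X-nonbasis) with ℕ.m≤n⇒m<n∨m≡n (rankF≤r X)
    ... | inj₁ rk<r = rk<r
    ... | inj₂ rk≡r with () ← trans (sym (r≤rankF⇒basis ∣X∣≡r (ℕ.≤-reflexive (sym rk≡r)))) X-nonbasis

    rankF<r⇒nonbasis : ∀ {X} → rk X < r → isBasis N X ≡ false
    rankF<r⇒nonbasis {X} rk<r with isBasis N X in X-basis?
    ... | true  = contradiction (basis⇒r≤rankF X-basis?) (ℕ.<⇒≱ rk<r)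
    ... | false = refl

    module _ {A Q : Subset n} (Q-basis : isBasis N Q ≡ true) where

      private
        element-outside : ∀ {P} → isBasis N P ≡ true → ∣ A ∩ P ∣ < ∣ A ∩ Q ∣ →
                          ∃[ y ] (y ∈ P × y ∉ A × y ∉ Q)
        element-outside {P} P-basis ∣A∩P∣<∣A∩Q∣ with ⊆⊎∃∉ (P ─ A) Q
        ... | inj₂ (y , y∈P─A , y∉Q) = let y∈P , y∉A = x∈p─q⁻ P A y∈P─A in y , y∈P , y∉A , y∉Q
        ... | inj₁ P─A⊆Q = contradiction (trans (hasRank P P-basis) (sym (hasRank Q Q-basis))) (ℕ.<⇒≢ ∣P∣<∣Q∣)
          where
          P─A⊆Q─A : P ─ A ⊆ Q ─ A
          P─A⊆Q─A y∈P─A = x∈p∧x∉q⇒x∈p─q (P─A⊆Q y∈P─A) (proj₂ (x∈p─q⁻ P A y∈P─A))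
          ∣P∣<∣Q∣ : ∣ P ∣ < ∣ Q ∣
          ∣P∣<∣Q∣ = begin-strict
            ∣ P ∣                  ≡⟨ ∣p∣≡∣p∩q∣+∣p─q∣ P A ⟩
            ∣ P ∩ A ∣ + ∣ P ─ A ∣  ≡⟨ cong (λ S → ∣ S ∣ + ∣ P ─ A ∣) (∩-comm P A) ⟩
            ∣ A ∩ P ∣ + ∣ P ─ A ∣  <⟨ ℕ.+-mono-<-≤ ∣A∩P∣<∣A∩Q∣ (p⊆q⇒∣p∣≤∣q∣ P─A⊆Q─A) ⟩
            ∣ A ∩ Q ∣ + ∣ Q ─ A ∣  ≡⟨ cong (λ S → ∣ S ∣ + ∣ Q ─ A ∣) (∩-comm A Q) ⟩
            ∣ Q ∩ A ∣ + ∣ Q ─ A ∣  ≡⟨ ∣p∣≡∣p∩q∣+∣p─q∣ Q A ⟨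
            ∣ Q ∣                  ∎
            where open ℕ.≤-Reasoning

      -- Exchange an element of P ∖ (A ∪ Q) for one of Q ∖ P; if the new element is outside A, the
      -- basis got closer to Q without changing its trace on A, so recurse.
      augment : ∀ d {P} → ∣ P ─ Q ∣ < d → isBasis N P ≡ true → ∣ A ∩ P ∣ < ∣ A ∩ Q ∣ →
                ∃[ P′ ] (isBasis N P′ ≡ true × A ∩ P ⊆ P′ × ∣ A ∩ P ∣ < ∣ A ∩ P′ ∣)
      augment (suc d) {P} ∣P─Q∣<1+d P-basis ∣A∩P∣<∣A∩Q∣ with element-outside P-basis ∣A∩P∣<∣A∩Q∣
      ... | y , y∈P , y∉A , y∉Q with exchange N P Q P-basis Q-basis y y∈P y∉Q
      ... | f , f∈Q , f∉P , P₁-basis with f ∈? A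
      ...   | yes f∈A =
        exch P y f , P₁-basis , p∩q⊆q A _ ∘′ ∩-⊆-∩exch f y∉A , p⊂q⇒∣p∣<∣q∣ (∩-⊂-∩exch y∉A f∈A f∉P)
      ...   | no f∉A
        with augment d (ℕ.<-≤-trans (∣exch─q∣<∣p─q∣ y∈P y∉Q f∈Q) (ℕ.s≤s⁻¹ ∣P─Q∣<1+d)) P₁-basis
                       (ℕ.≤-<-trans (p⊆q⇒∣p∣≤∣q∣ (∩exch-⊆-∩ y f∉A)) ∣A∩P∣<∣A∩Q∣)
      ...     | P′ , P′-basis , A∩P₁⊆P′ , ∣A∩P₁∣<∣A∩P′∣ =
        P′ , P′-basis , A∩P₁⊆P′ ∘′ ∩-⊆-∩exch f y∉A ,
        ℕ.≤-<-trans (p⊆q⇒∣p∣≤∣q∣ (∩-⊆-∩exch f y∉A)) ∣A∩P₁∣<∣A∩P′∣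

    extend-to-rank : ∀ k A {P} → isBasis N P ≡ true → rk A ≤ k + ∣ A ∩ P ∣ →
                     ∃[ P′ ] (isBasis N P′ ≡ true × A ∩ P ⊆ P′ × ∣ A ∩ P′ ∣ ≡ rk A)
    extend-to-rank zero    A {P} P-basis bound =
      P , P-basis , p∩q⊆q A P , ℕ.≤-antisym (∣X∩B∣≤rankF A P-basis) bound
    extend-to-rank (suc k) A {P} P-basis bound with ∣ A ∩ P ∣ <? rk A
    ... | no ∣A∩P∣≮rk =
      P , P-basis , p∩q⊆q A P , ℕ.≤-antisym (∣X∩B∣≤rankF A P-basis) (ℕ.≮⇒≥ ∣A∩P∣≮rk)
    ... | yes ∣A∩P∣<rk with rankF-attained A
    ...   | Q , Q-basis , rk≡∣A∩Q∣
      with augment Q-basis (suc ∣ P ─ Q ∣) (ℕ.n<1+n _) P-basis (subst (∣ A ∩ P ∣ <_) rk≡∣A∩Q∣ ∣A∩P∣<rk)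
    ...   | P₁ , P₁-basis , A∩P⊆P₁ , ∣A∩P∣<∣A∩P₁∣
      with extend-to-rank k A P₁-basis
             (ℕ.≤-trans bound (ℕ.≤-trans (ℕ.≤-reflexive (sym (ℕ.+-suc k _))) (ℕ.+-monoʳ-≤ k ∣A∩P∣<∣A∩P₁∣)))
    ...   | P′ , P′-basis , A∩P₁⊆P′ , ∣A∩P′∣≡rk =
      P′ , P′-basis , A∩P₁⊆P′ ∘′ A∩P⊆A∩P₁ , ∣A∩P′∣≡rk
      where
      A∩P⊆A∩P₁ : A ∩ P ⊆ A ∩ P₁
      A∩P⊆A∩P₁ x∈ = x∈p∩q⁺ (proj₁ (x∈p∩q⁻ A P x∈) , A∩P⊆P₁ x∈)

    rankF-submodular : ∀ X Y → rk (X ∪ Y) + rk (X ∩ Y) ≤ rk X + rk Y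
    rankF-submodular X Y with rankF-attained (X ∩ Y)
    ... | P₀ , P₀-basis , rk∩≡ with extend-to-rank (rk (X ∪ Y)) (X ∪ Y) P₀-basis (ℕ.m≤m+n _ _)
    ... | P , P-basis , X∪Y∩P₀⊆P , ∣X∪Y∩P∣≡rk = begin
      rk (X ∪ Y) + rk (X ∩ Y)  ≤⟨ ℕ.+-mono-≤ (ℕ.≤-reflexive (sym ∣X∪Y∩P∣≡rk)) rk[X∩Y]≤ ⟩
      ∣ (X ∪ Y) ∩ P ∣ + ∣ I ∣  ≡⟨ cong (λ S → ∣ S ∣ + ∣ I ∣) (∩-distribʳ-∪ P X Y) ⟩
      ∣ U ∣ + ∣ I ∣            ≡⟨ ∣p∪q∣+∣p∩q∣≡∣p∣+∣q∣ (X ∩ P) (Y ∩ P) ⟩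
      ∣ X ∩ P ∣ + ∣ Y ∩ P ∣    ≤⟨ ℕ.+-mono-≤ (∣X∩B∣≤rankF X P-basis) (∣X∩B∣≤rankF Y P-basis) ⟩
      rk X + rk Y              ∎
      where
      open ℕ.≤-Reasoning
      U = (X ∩ P) ∪ (Y ∩ P)
      I = (X ∩ P) ∩ (Y ∩ P)
      X∩Y∩P₀⊆ : (X ∩ Y) ∩ P₀ ⊆ I
      X∩Y∩P₀⊆ z∈ with x∈p∩q⁻ (X ∩ Y) P₀ z∈
      ... | z∈X∩Y , z∈P₀ with x∈p∩q⁻ X Y z∈X∩Y
      ...   | z∈X , z∈Y = let z∈P = X∪Y∩P₀⊆P (x∈p∩q⁺ (x∈p∪q⁺ (inj₁ z∈X) , z∈P₀)) in
                          x∈p∩q⁺ (x∈p∩q⁺ (z∈X , z∈P) , x∈p∩q⁺ (z∈Y , z∈P))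
      rk[X∩Y]≤ : rk (X ∩ Y) ≤ ∣ I ∣
      rk[X∩Y]≤ = ℕ.≤-trans (ℕ.≤-reflexive rk∩≡) (p⊆q⇒∣p∣≤∣q∣ X∩Y∩P₀⊆)

    -- Closure and coloops

    rankF-∪-≤ : ∀ X Y → rk (X ∪ Y) ≤ rk X + ∣ Y ∣
    rankF-∪-≤ X Y = begin
      rk (X ∪ Y)               ≤⟨ ℕ.m≤m+n _ _ ⟩
      rk (X ∪ Y) + rk (X ∩ Y)  ≤⟨ rankF-submodular X Y ⟩
      rk X + rk Y              ≤⟨ ℕ.+-monoʳ-≤ (rk X) (rankF≤∣X∣ Y) ⟩
      rk X + ∣ Y ∣             ∎
      where open ℕ.≤-Reasoning

    rankF-∪⁅⁆-≤ : ∀ {X Z} y → Z ⊆ X ∪ ⁅ y ⁆ → rk Z ≤ suc (rk X)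
    rankF-∪⁅⁆-≤ {X} y Z⊆ = begin
      rk _              ≤⟨ rankF-mono Z⊆ ⟩
      rk (X ∪ ⁅ y ⁆)    ≤⟨ rankF-∪-≤ X ⁅ y ⁆ ⟩
      rk X + ∣ ⁅ y ⁆ ∣  ≡⟨ cong (rk X +_) (∣⁅x⁆∣≡1 y) ⟩
      rk X + 1          ≡⟨ ℕ.+-comm (rk X) 1 ⟩
      suc (rk X)        ∎
      where open ℕ.≤-Reasoning

    private
      spans? : ∀ X e → Dec (rk (X ∪ ⁅ e ⁆) ≤ rk X)
      spans? X e = rk (X ∪ ⁅ e ⁆) ≤? rk X

    closure : Subset n → Subset n
    closure X = tabulate λ e → does (spans? X e)

    ∈closure⁺ : ∀ {X e} → rk (X ∪ ⁅ e ⁆) ≤ rk X → e ∈ closure X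
    ∈closure⁺ {X} {e} spans = lookup⇒[]= e (closure X) (trans (lookup∘tabulate _ e) (decided (spans? X e)))
      where
      decided : (d : Dec (rk (X ∪ ⁅ e ⁆) ≤ rk X)) → does d ≡ true
      decided (yes _)     = refl
      decided (no ¬spans) = contradiction spans ¬spans

    ∈closure⁻ : ∀ {X e} → e ∈ closure X → rk (X ∪ ⁅ e ⁆) ≤ rk X
    ∈closure⁻ {X} {e} e∈ = witness (spans? X e) (trans (sym (lookup∘tabulate _ e)) ([]=⇒lookup e∈))
      where
      witness : (d : Dec (rk (X ∪ ⁅ e ⁆) ≤ rk X)) → does d ≡ true → rk (X ∪ ⁅ e ⁆) ≤ rk X
      witness (yes spans) _ = spans

    ∉closure⇒< : ∀ {X e} → e ∉ closure X → rk X < rk (X ∪ ⁅ e ⁆)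
    ∉closure⇒< e∉ = ℕ.≰⇒> (e∉ ∘′ ∈closure⁺)

    closure-mono : ∀ {W V} → W ⊆ V → closure W ⊆ closure V
    closure-mono {W} {V} W⊆V {e} e∈ = ∈closure⁺ (ℕ.+-cancelʳ-≤ (rk W) _ _ (begin
      rk (V ∪ ⁅ e ⁆) + rk W                        ≤⟨ ℕ.+-mono-≤ (rankF-mono V∪e⊆) (rankF-mono W⊆) ⟩
      rk (V ∪ (W ∪ ⁅ e ⁆)) + rk (V ∩ (W ∪ ⁅ e ⁆))  ≤⟨ rankF-submodular V (W ∪ ⁅ e ⁆) ⟩
      rk V + rk (W ∪ ⁅ e ⁆)                        ≤⟨ ℕ.+-monoʳ-≤ (rk V) (∈closure⁻ e∈) ⟩
      rk V + rk W                                  ∎))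
      where
      open ℕ.≤-Reasoning
      V∪e⊆ : V ∪ ⁅ e ⁆ ⊆ V ∪ (W ∪ ⁅ e ⁆)
      V∪e⊆ z∈ with x∈p∪q⁻ V ⁅ e ⁆ z∈
      ... | inj₁ z∈V = x∈p∪q⁺ (inj₁ z∈V)
      ... | inj₂ z∈e = x∈p∪q⁺ (inj₂ (x∈p∪q⁺ (inj₂ z∈e)))
      W⊆ : W ⊆ V ∩ (W ∪ ⁅ e ⁆)
      W⊆ z∈W = x∈p∩q⁺ (W⊆V z∈W , x∈p∪q⁺ (inj₁ z∈W))

    private
      rankF-∪-closure-by : ∀ k {A F} → ∣ F ∣ ≡ k → F ⊆ closure A → rk (A ∪ F) ≤ rk A
      rankF-∪-closure-by zero {A} {F} ∣F∣≡0 _ = rankF-mono A∪F⊆A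
        where
        A∪F⊆A : A ∪ F ⊆ A
        A∪F⊆A z∈ with x∈p∪q⁻ A F z∈
        ... | inj₁ z∈A = z∈A
        ... | inj₂ z∈F = contradiction ∣F∣≡0 (ℕ.>⇒≢ (x∈p⇒0<∣p∣ z∈F))
      rankF-∪-closure-by (suc k) {A} {F} ∣F∣≡1+k F⊆
        with 0<∣p∣⇒Nonempty F (subst (0 <_) (sym ∣F∣≡1+k) (s≤s z≤n))
      ... | f , f∈F = begin
        rk (A ∪ F)                  ≤⟨ rankF-mono A∪F⊆ ⟩
        rk ((A ∪ (F - f)) ∪ ⁅ f ⁆)  ≤⟨ ∈closure⁻ (closure-mono (p⊆p∪q (F - f)) (F⊆ f∈F)) ⟩
        rk (A ∪ (F - f))            ≤⟨ rankF-∪-closure-by k ∣F-f∣≡k (F⊆ ∘′ proj₁ ∘′ x∈p-y⁻ F) ⟩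
        rk A                        ∎
        where
        open ℕ.≤-Reasoning
        ∣F-f∣≡k : ∣ F - f ∣ ≡ k
        ∣F-f∣≡k = ℕ.suc-injective (trans (sym (∣p∣≡1+∣p-x∣ F f∈F)) ∣F∣≡1+k)
        A∪F⊆ : A ∪ F ⊆ (A ∪ (F - f)) ∪ ⁅ f ⁆
        A∪F⊆ {z} z∈ with x∈p∪q⁻ A F z∈ | z Fin.≟ f
        ... | inj₁ z∈A | _        = x∈p∪q⁺ (inj₁ (x∈p∪q⁺ (inj₁ z∈A)))
        ... | inj₂ _   | yes refl = x∈p∪q⁺ (inj₂ (x∈⁅x⁆ f))
        ... | inj₂ z∈F | no z≢f   = x∈p∪q⁺ (inj₁ (x∈p∪q⁺ (inj₂ (x∈p∧x≢y⇒x∈p-y z∈F z≢f))))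

    rankF-∪-closure : ∀ {A F} → F ⊆ closure A → rk (A ∪ F) ≤ rk A
    rankF-∪-closure = rankF-∪-closure-by _ refl

    closure-∪-closure : ∀ {A F} → F ⊆ closure A → closure (A ∪ F) ⊆ closure A
    closure-∪-closure {A} {F} F⊆ {e} e∈ = ∈closure⁺ (begin
      rk (A ∪ ⁅ e ⁆)        ≤⟨ rankF-mono A∪e⊆ ⟩
      rk ((A ∪ F) ∪ ⁅ e ⁆)  ≤⟨ ∈closure⁻ e∈ ⟩
      rk (A ∪ F)            ≤⟨ rankF-∪-closure F⊆ ⟩
      rk A                  ∎)
      where
      open ℕ.≤-Reasoning
      A∪e⊆ : A ∪ ⁅ e ⁆ ⊆ (A ∪ F) ∪ ⁅ e ⁆
      A∪e⊆ z∈ with x∈p∪q⁻ A ⁅ e ⁆ z∈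
      ... | inj₁ z∈A = x∈p∪q⁺ (inj₁ (x∈p∪q⁺ (inj₁ z∈A)))
      ... | inj₂ z∈e = x∈p∪q⁺ (inj₂ z∈e)

    private
      coloop-of-minus : ∀ Y {g g′} → g ≢ g′ → rk (Y - g′) < rk Y → rk ((Y - g) - g′) < rk (Y - g)
      coloop-of-minus Y {g} {g′} g≢g′ g′-coloop = ℕ.+-cancelˡ-≤ (rk Y) _ _ (begin
        rk Y + suc (rk ((Y - g) - g′))                           ≡⟨ ℕ.+-suc _ _ ⟩
        suc (rk Y + rk ((Y - g) - g′))                           ≤⟨ s≤s (ℕ.+-mono-≤ (rankF-mono Y⊆) (rankF-mono Y-g-g′⊆)) ⟩
        suc (rk ((Y - g) ∪ (Y - g′)) + rk ((Y - g) ∩ (Y - g′)))  ≤⟨ s≤s (rankF-submodular (Y - g) (Y - g′)) ⟩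
        suc (rk (Y - g) + rk (Y - g′))                           ≡⟨ ℕ.+-suc _ _ ⟨
        rk (Y - g) + suc (rk (Y - g′))                           ≤⟨ ℕ.+-monoʳ-≤ (rk (Y - g)) g′-coloop ⟩
        rk (Y - g) + rk Y                                        ≡⟨ ℕ.+-comm (rk (Y - g)) (rk Y) ⟩
        rk Y + rk (Y - g)                                        ∎)
        where
        open ℕ.≤-Reasoning
        Y⊆ : Y ⊆ (Y - g) ∪ (Y - g′)
        Y⊆ {z} z∈Y with z Fin.≟ g
        ... | yes refl = x∈p∪q⁺ (inj₂ (x∈p∧x≢y⇒x∈p-y z∈Y g≢g′))
        ... | no z≢g   = x∈p∪q⁺ (inj₁ (x∈p∧x≢y⇒x∈p-y z∈Y z≢g))
        Y-g-g′⊆ : (Y - g) - g′ ⊆ (Y - g) ∩ (Y - g′)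
        Y-g-g′⊆ z∈ with x∈p-y⁻ (Y - g) z∈
        ... | z∈Y-g , z≢g′ = x∈p∩q⁺ (z∈Y-g , x∈p∧x≢y⇒x∈p-y (proj₁ (x∈p-y⁻ Y z∈Y-g)) z≢g′)

      rankF-─-coloops-by : ∀ k Y {G} → ∣ G ∣ ≡ k → (∀ {g} → g ∈ G → rk (Y - g) < rk Y) → rk (Y ─ G) + k ≤ rk Y
      rankF-─-coloops-by zero Y {G} _ _ = ℕ.≤-trans (ℕ.≤-reflexive (ℕ.+-identityʳ _)) (rankF-mono (p─q⊆p Y G))
      rankF-─-coloops-by (suc k) Y {G} ∣G∣≡1+k coloops
        with 0<∣p∣⇒Nonempty G (subst (0 <_) (sym ∣G∣≡1+k) (s≤s z≤n))
      ... | g , g∈G = begin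
        rk (Y ─ G) + suc k                ≡⟨ ℕ.+-suc _ _ ⟩
        suc (rk (Y ─ G) + k)              ≤⟨ s≤s (ℕ.+-monoˡ-≤ k (rankF-mono Y─G⊆)) ⟩
        suc (rk ((Y - g) ─ (G - g)) + k)  ≤⟨ s≤s (rankF-─-coloops-by k (Y - g) ∣G-g∣≡k coloops′) ⟩
        suc (rk (Y - g))                  ≤⟨ coloops g∈G ⟩
        rk Y                              ∎
        where
        open ℕ.≤-Reasoning
        ∣G-g∣≡k : ∣ G - g ∣ ≡ k
        ∣G-g∣≡k = ℕ.suc-injective (trans (sym (∣p∣≡1+∣p-x∣ G g∈G)) ∣G∣≡1+k)
        coloops′ : ∀ {g′} → g′ ∈ G - g → rk ((Y - g) - g′) < rk (Y - g)
        coloops′ g′∈ with x∈p-y⁻ G g′∈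
        ... | g′∈G , g′≢g = coloop-of-minus Y (λ { refl → g′≢g refl }) (coloops g′∈G)
        Y─G⊆ : Y ─ G ⊆ (Y - g) ─ (G - g)
        Y─G⊆ z∈ with x∈p─q⁻ Y G z∈
        ... | z∈Y , z∉G =
          x∈p∧x∉q⇒x∈p─q (x∈p∧x≢y⇒x∈p-y z∈Y (λ { refl → z∉G g∈G })) (z∉G ∘′ proj₁ ∘′ x∈p-y⁻ G)

    rankF-─-coloops : ∀ Y {G} → (∀ {g} → g ∈ G → rk (Y - g) < rk Y) → rk (Y ─ G) + ∣ G ∣ ≤ rk Y
    rankF-─-coloops Y = rankF-─-coloops-by _ Y refl

    -- In Y ∪ {e} every g ∈ G is a coloop, so
    -- rk ((Y ─ G) ∪ {e}) + |G| ≤ rk (Y ∪ {e}) ≤ rk Y ≤ rk (Y ─ G) + |G|.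
    ∈closure-─ : ∀ {Y G e g₀} → e ∉ Y → G ⊆ Y → g₀ ∈ G → (∀ {g} → g ∈ G → rk (exch Y g e) < rk Y) →
                 e ∈ closure (Y ─ G)
    ∈closure-─ {Y} {G} {e} {g₀} e∉Y G⊆Y g₀∈G shrinks = ∈closure⁺ (ℕ.+-cancelʳ-≤ ∣ G ∣ _ _ (begin
      rk ((Y ─ G) ∪ ⁅ e ⁆) + ∣ G ∣  ≤⟨ ℕ.+-monoˡ-≤ ∣ G ∣ (rankF-mono Y─G∪e⊆) ⟩
      rk (Y ∪ ⁅ e ⁆ ─ G) + ∣ G ∣    ≤⟨ rankF-─-coloops (Y ∪ ⁅ e ⁆) coloops ⟩
      rk (Y ∪ ⁅ e ⁆)                ≤⟨ ℕ.≤-trans (rankF-∪⁅⁆-≤ g₀ Y∪e⊆) (shrinks g₀∈G) ⟩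
      rk Y                          ≤⟨ rankF-mono Y⊆ ⟩
      rk ((Y ─ G) ∪ G)              ≤⟨ rankF-∪-≤ (Y ─ G) G ⟩
      rk (Y ─ G) + ∣ G ∣            ∎))
      where
      open ℕ.≤-Reasoning
      coloops : ∀ {g} → g ∈ G → rk (Y ∪ ⁅ e ⁆ - g) < rk (Y ∪ ⁅ e ⁆)
      coloops {g} g∈G = ℕ.<-≤-trans (ℕ.≤-<-trans (rankF-mono ⊆exch) (shrinks g∈G)) (rankF-mono (p⊆p∪q ⁅ e ⁆))
        where
        ⊆exch : Y ∪ ⁅ e ⁆ - g ⊆ exch Y g e
        ⊆exch z∈ with x∈p-y⁻ (Y ∪ ⁅ e ⁆) z∈
        ... | z∈Y∪e , z≢g with x∈p∪q⁻ Y ⁅ e ⁆ z∈Y∪e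
        ...   | inj₁ z∈Y = ∈-exch⁺ z∈Y z≢g
        ...   | inj₂ z∈e rewrite x∈⁅y⁆⇒x≡y e z∈e = b∈exch Y g e
      Y∪e⊆ : Y ∪ ⁅ e ⁆ ⊆ exch Y g₀ e ∪ ⁅ g₀ ⁆
      Y∪e⊆ {z} z∈ with x∈p∪q⁻ Y ⁅ e ⁆ z∈ | z Fin.≟ g₀
      ... | _        | yes refl = x∈p∪q⁺ (inj₂ (x∈⁅x⁆ g₀))
      ... | inj₁ z∈Y | no z≢g₀  = x∈p∪q⁺ (inj₁ (∈-exch⁺ z∈Y z≢g₀))
      ... | inj₂ z∈e | no _     rewrite x∈⁅y⁆⇒x≡y e z∈e = x∈p∪q⁺ (inj₁ (b∈exch Y g₀ e))
      Y─G∪e⊆ : (Y ─ G) ∪ ⁅ e ⁆ ⊆ Y ∪ ⁅ e ⁆ ─ G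
      Y─G∪e⊆ z∈ with x∈p∪q⁻ (Y ─ G) ⁅ e ⁆ z∈
      ... | inj₁ z∈Y─G = let z∈Y , z∉G = x∈p─q⁻ Y G z∈Y─G in x∈p∧x∉q⇒x∈p─q (x∈p∪q⁺ (inj₁ z∈Y)) z∉G
      ... | inj₂ z∈e rewrite x∈⁅y⁆⇒x≡y e z∈e =
        x∈p∧x∉q⇒x∈p─q (x∈p∪q⁺ (inj₂ (x∈⁅x⁆ e))) (e∉Y ∘′ G⊆Y)
      Y⊆ : Y ⊆ (Y ─ G) ∪ G
      Y⊆ {z} z∈Y with z ∈? G
      ... | yes z∈G = x∈p∪q⁺ (inj₂ z∈G)
      ... | no z∉G  = x∈p∪q⁺ (inj₁ (x∈p∧x∉q⇒x∈p─q z∈Y z∉G))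

    dependent-⊆ : ∀ {D Z} → rk D < ∣ D ∣ → D ⊆ Z → rk Z < ∣ Z ∣
    dependent-⊆ {D} {Z} D-dependent D⊆Z = begin-strict
      rk Z                   ≤⟨ rankF-mono Z⊆ ⟩
      rk (D ∪ (Z ─ D))       ≤⟨ rankF-∪-≤ D (Z ─ D) ⟩
      rk D + ∣ Z ─ D ∣       <⟨ ℕ.+-monoˡ-< ∣ Z ─ D ∣ D-dependent ⟩
      ∣ D ∣ + ∣ Z ─ D ∣      ≤⟨ ℕ.+-monoˡ-≤ ∣ Z ─ D ∣ (p⊆q⇒∣p∣≤∣q∣ D⊆Z∩D) ⟩
      ∣ Z ∩ D ∣ + ∣ Z ─ D ∣  ≡⟨ ∣p∣≡∣p∩q∣+∣p─q∣ Z D ⟨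
      ∣ Z ∣                  ∎
      where
      open ℕ.≤-Reasoning
      D⊆Z∩D : D ⊆ Z ∩ D
      D⊆Z∩D z∈D = x∈p∩q⁺ (D⊆Z z∈D , z∈D)
      Z⊆ : Z ⊆ D ∪ (Z ─ D)
      Z⊆ {z} z∈Z with z ∈? D
      ... | yes z∈D = x∈p∪q⁺ (inj₁ z∈D)
      ... | no z∉D  = x∈p∪q⁺ (inj₂ (x∈p∧x∉q⇒x∈p─q z∈Z z∉D))

    -- A rank exchange compatible with the components of the non-bases

    BasisOrConnected : Subset n → Subset n → Set
    BasisOrConnected X Z = isBasis N X ≡ false → Connected N r X Z

    -- The two ways in which an exchange (B, B′) ↦ (X, Y) survives rescaling ν_N by a factor that
    -- is constant on components.
    data RankExchange (B B′ X Y : Subset n) : Set where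
      both-grow     : rk B ≤ rk X → rk B′ ≤ rk Y → RankExchange B B′ X Y
      one-component : rk B + rk B′ ≤ rk X + rk Y → ∀ {Z} →
                      BasisOrConnected B Z → BasisOrConnected B′ Z →
                      BasisOrConnected X Z → BasisOrConnected Y Z → RankExchange B B′ X Y

    module _ {B B′ : Subset n} (∣B∣≡r : ∣ B ∣ ≡ r) (∣B′∣≡r : ∣ B′ ∣ ≡ r)
             {e} (e∈B : e ∈ B) (e∉B′ : e ∉ B′) where

      private
        open ℕ.≤-Reasoning

        A = B - e
        F = B′ ─ B
        T = B ∩ B′

        X Y : Fin n → Subset n
        X f = exch B e f
        Y f = exch B′ f e

        module _ {f} (f∈F : f ∈ F) where
          f∈B′ : f ∈ B′
          f∈B′ = proj₁ (x∈p─q⁻ B′ B f∈F)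
          f∉B : f ∉ B
          f∉B = proj₂ (x∈p─q⁻ B′ B f∈F)
          ∣X∣≡r : ∣ X f ∣ ≡ r
          ∣X∣≡r = trans (∣exch∣≡∣p∣ B e∈B f∉B) ∣B∣≡r
          ∣Y∣≡r : ∣ Y f ∣ ≡ r
          ∣Y∣≡r = trans (∣exch∣≡∣p∣ B′ f∈B′ e∉B′) ∣B′∣≡r
          rk-B′≤1+rk-Y : rk B′ ≤ suc (rk (Y f))
          rk-B′≤1+rk-Y = rankF-∪⁅⁆-≤ f B′⊆
            where
            B′⊆ : B′ ⊆ Y f ∪ ⁅ f ⁆
            B′⊆ {z} z∈B′ with z Fin.≟ f
            ... | yes refl = x∈p∪q⁺ (inj₂ (x∈⁅x⁆ f))
            ... | no z≢f   = x∈p∪q⁺ (inj₁ (∈-exch⁺ z∈B′ z≢f))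

        rk-B≡ : rk B ≡ rk (A ∪ ⁅ e ⁆)
        rk-B≡ = cong rk (sym (p-x∪⁅x⁆≡p B e∈B))

        rk-B≤1+rk-A : rk B ≤ suc (rk A)
        rk-B≤1+rk-A = rankF-∪⁅⁆-≤ e (⊆-reflexive (sym (p-x∪⁅x⁆≡p B e∈B)))

        e∈cl⇒rk-B≤rk-A : e ∈ closure A → rk B ≤ rk A
        e∈cl⇒rk-B≤rk-A e∈clA = ℕ.≤-trans (ℕ.≤-reflexive rk-B≡) (∈closure⁻ e∈clA)

        e∉cl⇒rk-A<rk-B : e ∉ closure A → rk A < rk B
        e∉cl⇒rk-A<rk-B e∉clA = ℕ.<-≤-trans (∉closure⇒< e∉clA) (ℕ.≤-reflexive (sym rk-B≡))

        rk-A<rk-T+∣F∣ : rk A < rk T + ∣ F ∣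
        rk-A<rk-T+∣F∣ = begin-strict
          rk A                     ≤⟨ rankF-mono A⊆ ⟩
          rk (T ∪ ((B ─ B′) - e))  ≤⟨ rankF-∪-≤ T ((B ─ B′) - e) ⟩
          rk T + ∣ (B ─ B′) - e ∣  <⟨ ℕ.+-monoʳ-< (rk T) (x∈p⇒∣p-x∣<∣p∣ (x∈p∧x∉q⇒x∈p─q e∈B e∉B′)) ⟩
          rk T + ∣ B ─ B′ ∣        ≡⟨ cong (rk T +_) (∣p─q∣≡∣q─p∣ B B′ (trans ∣B∣≡r (sym ∣B′∣≡r))) ⟩
          rk T + ∣ F ∣             ∎
          where
          A⊆ : A ⊆ T ∪ ((B ─ B′) - e)
          A⊆ {z} z∈A with x∈p-y⁻ B z∈A | z ∈? B′
          ... | z∈B , _   | yes z∈B′ = x∈p∪q⁺ (inj₁ (x∈p∩q⁺ (z∈B , z∈B′)))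
          ... | z∈B , z≢e | no z∉B′  = x∈p∪q⁺ (inj₂ (x∈p∧x≢y⇒x∈p-y (x∈p∧x∉q⇒x∈p─q z∈B z∉B′) z≢e))

        B′⊆A∪F : B′ ⊆ A ∪ F
        B′⊆A∪F {z} z∈B′ with z ∈? B
        ... | yes z∈B = x∈p∪q⁺ (inj₁ (x∈p∧x≢y⇒x∈p-y z∈B (λ { refl → e∉B′ z∈B′ })))
        ... | no z∉B  = x∈p∪q⁺ (inj₂ (x∈p∧x∉q⇒x∈p─q z∈B′ z∉B))

        B′─G⊆A∪[F─G] : ∀ G → B′ ─ G ⊆ A ∪ (F ─ G)
        B′─G⊆A∪[F─G] G {z} z∈ with x∈p─q⁻ B′ G z∈ | z ∈? B
        ... | z∈B′ , _   | yes z∈B = x∈p∪q⁺ (inj₁ (x∈p∧x≢y⇒x∈p-y z∈B (λ { refl → e∉B′ z∈B′ })))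
        ... | z∈B′ , z∉G | no z∉B  = x∈p∪q⁺ (inj₂ (x∈p∧x∉q⇒x∈p─q (x∈p∧x∉q⇒x∈p─q z∈B′ z∉B) z∉G))

        B′─F⊆T : B′ ─ F ⊆ T
        B′─F⊆T {z} z∈ with x∈p─q⁻ B′ F z∈ | z ∈? B
        ... | z∈B′ , _   | yes z∈B = x∈p∩q⁺ (z∈B , z∈B′)
        ... | z∈B′ , z∉F | no z∉B  = contradiction (x∈p∧x∉q⇒x∈p─q z∈B′ z∉B) z∉F

        T⊆B′─F : T ⊆ B′ ─ F
        T⊆B′─F z∈ with x∈p∩q⁻ B B′ z∈
        ... | z∈B , z∈B′ = x∈p∧x∉q⇒x∈p─q z∈B′ (λ z∈F → proj₂ (x∈p─q⁻ B′ B z∈F) z∈B)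

        no-spanned-coloops : F ⊆ closure A → (∀ {f} → f ∈ F → rk (B′ - f) < rk B′) → ⊥
        no-spanned-coloops F⊆clA coloops = ℕ.<-irrefl refl (begin-strict
          rk A                 <⟨ rk-A<rk-T+∣F∣ ⟩
          rk T + ∣ F ∣         ≤⟨ ℕ.+-monoˡ-≤ ∣ F ∣ (rankF-mono T⊆B′─F) ⟩
          rk (B′ ─ F) + ∣ F ∣  ≤⟨ rankF-─-coloops B′ coloops ⟩
          rk B′                ≤⟨ rankF-mono B′⊆A∪F ⟩
          rk (A ∪ F)           ≤⟨ rankF-∪-closure F⊆clA ⟩
          rk A                 ∎)

        free-forces-spanned : e ∉ closure A → (∀ {g} → g ∈ F ─ closure A → rk (Y g) < rk B′) → F ⊆ closure A
        free-forces-spanned e∉clA shrinks {f} f∈F with f ∈? closure A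
        ... | yes f∈clA = f∈clA
        ... | no f∉clA  = contradiction e∈clA e∉clA
          where
          G = F ─ closure A
          F─G⊆clA : F ─ G ⊆ closure A
          F─G⊆clA {z} z∈ with x∈p─q⁻ F G z∈ | z ∈? closure A
          ... | _         | yes z∈clA = z∈clA
          ... | z∈F , z∉G | no z∉clA  = contradiction (x∈p∧x∉q⇒x∈p─q z∈F z∉clA) z∉G
          G⊆B′ : G ⊆ B′
          G⊆B′ = p─q⊆p B′ B ∘′ p─q⊆p F (closure A)
          e∈clA : e ∈ closure A
          e∈clA = closure-∪-closure F─G⊆clA
                    (closure-mono (B′─G⊆A∪[F─G] G) (∈closure-─ e∉B′ G⊆B′ (x∈p∧x∉q⇒x∈p─q f∈F f∉clA) shrinks))

        grow-when-spanned : e ∈ closure A → ∀ {f} → rk B′ ≤ rk (Y f) → RankExchange B B′ (X f) (Y f)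
        grow-when-spanned e∈clA {f} grows =
          both-grow (ℕ.≤-trans (e∈cl⇒rk-B≤rk-A e∈clA) (rankF-mono (p⊆p∪q ⁅ f ⁆))) grows

        grow-when-free : ∀ {f} → f ∉ closure A → rk B′ ≤ rk (Y f) → RankExchange B B′ (X f) (Y f)
        grow-when-free f∉clA grows = both-grow (ℕ.≤-trans rk-B≤1+rk-A (∉closure⇒< f∉clA)) grows

        -- T ∪ {e} is dependent, and it lies in every r-set between B and Y f.
        component-of-B : e ∈ closure A → (∀ {g} → g ∈ F → rk (Y g) < rk B′) →
                         ∀ {f} → f ∈ F → f ∉ closure A → RankExchange B B′ (X f) (Y f)
        component-of-B e∈clA shrinks {f} f∈F f∉clA =
          one-component ineq (λ _ → here B-nb)
            (λ B′-nb → step (∣B′∣≡r , B′-nb) (Adjacent-exch (f∈B′ f∈F) e∉B′) Y~B)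
            (λ X-nb → step (∣X∣≡r f∈F , X-nb) (exch-Adjacent e∈B (f∉B f∈F)) (here B-nb))
            (λ _ → Y~B)
          where
          ineq : rk B + rk B′ ≤ rk (X f) + rk (Y f)
          ineq = begin
            rk B + rk B′           ≤⟨ ℕ.+-monoʳ-≤ (rk B) (rk-B′≤1+rk-Y f∈F) ⟩
            rk B + suc (rk (Y f))  ≡⟨ ℕ.+-suc (rk B) _ ⟩
            suc (rk B) + rk (Y f)  ≤⟨ ℕ.+-monoˡ-≤ (rk (Y f)) (s≤s (e∈cl⇒rk-B≤rk-A e∈clA)) ⟩
            suc (rk A) + rk (Y f)  ≤⟨ ℕ.+-monoˡ-≤ (rk (Y f)) (∉closure⇒< f∉clA) ⟩
            rk (X f) + rk (Y f)    ∎
          D = T ∪ ⁅ e ⁆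
          e∈clT : e ∈ closure T
          e∈clT = closure-mono B′─F⊆T (∈closure-─ e∉B′ (p─q⊆p B′ B) f∈F shrinks)
          D-dependent : rk D < ∣ D ∣
          D-dependent = begin-strict
            rk D       ≤⟨ ∈closure⁻ e∈clT ⟩
            rk T       ≤⟨ rankF≤∣X∣ T ⟩
            ∣ T ∣      <⟨ ℕ.n<1+n _ ⟩
            suc ∣ T ∣  ≡⟨ ∣p∪⁅x⁆∣≡1+∣p∣ T (e∉B′ ∘′ proj₂ ∘′ x∈p∩q⁻ B B′) ⟨
            ∣ D ∣      ∎
          ⊇D⇒nonbasis : ∀ {Z} → ∣ Z ∣ ≡ r → D ⊆ Z → isBasis N Z ≡ false
          ⊇D⇒nonbasis {Z} ∣Z∣≡r D⊆Z = rankF<r⇒nonbasis (subst (rk Z <_) ∣Z∣≡r (dependent-⊆ D-dependent D⊆Z))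
          D⊆B∩Y : D ⊆ B ∩ Y f
          D⊆B∩Y z∈ with x∈p∪q⁻ T ⁅ e ⁆ z∈
          ... | inj₁ z∈T = let z∈B , z∈B′ = x∈p∩q⁻ B B′ z∈T in
                           x∈p∩q⁺ (z∈B , ∈-exch⁺ z∈B′ (λ { refl → f∉B f∈F z∈B }))
          ... | inj₂ z∈e rewrite x∈⁅y⁆⇒x≡y e z∈e = x∈p∩q⁺ (e∈B , b∈exch B′ f e)
          B-nb : NonBasis N r B
          B-nb = ∣B∣≡r , ⊇D⇒nonbasis ∣B∣≡r (p∩q⊆p B (Y f) ∘′ D⊆B∩Y)
          Y~B : Connected N r (Y f) B
          Y~B = Connected-sym N (interval N ∣B∣≡r (∣Y∣≡r f∈F) λ ∣Z∣≡r B∩Y⊆Z _ →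
                                   ⊇D⇒nonbasis ∣Z∣≡r (B∩Y⊆Z ∘′ D⊆B∩Y))

        -- A ∪ F has rank below r and contains every r-set between X f and B′.
        component-of-B′ : e ∉ closure A → F ⊆ closure A → ∀ {f} → f ∈ F → rk B′ ≤ rk (B′ - f) →
                          RankExchange B B′ (X f) (Y f)
        component-of-B′ e∉clA F⊆clA {f} f∈F not-coloop =
          one-component ineq
            (λ B-nb → step (∣B∣≡r , B-nb) (Adjacent-exch e∈B (f∉B f∈F)) X~B′)
            (λ _ → here B′-nb)
            (λ _ → X~B′)
            (λ Y-nb → step (∣Y∣≡r f∈F , Y-nb) (exch-Adjacent (f∈B′ f∈F) e∉B′) (here B′-nb))
          where
          U = A ∪ F
          ⊆U⇒nonbasis : ∀ {Z} → Z ⊆ U → isBasis N Z ≡ false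
          ⊆U⇒nonbasis {Z} Z⊆U = rankF<r⇒nonbasis (begin-strict
            rk Z  ≤⟨ rankF-mono Z⊆U ⟩
            rk U  ≤⟨ rankF-∪-closure F⊆clA ⟩
            rk A  <⟨ e∉cl⇒rk-A<rk-B e∉clA ⟩
            rk B  ≤⟨ rankF≤r B ⟩
            r     ∎)
          e∉cl[B′-f] : e ∉ closure (B′ - f)
          e∉cl[B′-f] e∈ = e∉clA (closure-∪-closure F⊆clA (closure-mono (B′⊆A∪F ∘′ proj₁ ∘′ x∈p-y⁻ B′) e∈))
          ineq : rk B + rk B′ ≤ rk (X f) + rk (Y f)
          ineq = begin
            rk B + rk B′                  ≤⟨ ℕ.+-monoˡ-≤ (rk B′) rk-B≤1+rk-A ⟩
            suc (rk A) + rk B′            ≤⟨ ℕ.+-mono-≤ (s≤s (rankF-mono (p⊆p∪q ⁅ f ⁆))) not-coloop ⟩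
            suc (rk (X f)) + rk (B′ - f)  ≡⟨ ℕ.+-suc _ _ ⟨
            rk (X f) + suc (rk (B′ - f))  ≤⟨ ℕ.+-monoʳ-≤ (rk (X f)) (∉closure⇒< e∉cl[B′-f]) ⟩
            rk (X f) + rk (Y f)           ∎
          B′-nb : NonBasis N r B′
          B′-nb = ∣B′∣≡r , ⊆U⇒nonbasis B′⊆A∪F
          X∪B′⊆U : X f ∪ B′ ⊆ U
          X∪B′⊆U z∈ with x∈p∪q⁻ (X f) B′ z∈
          ... | inj₂ z∈B′ = B′⊆A∪F z∈B′
          ... | inj₁ z∈X with x∈p∪q⁻ A ⁅ f ⁆ z∈X
          ...   | inj₁ z∈A = x∈p∪q⁺ (inj₁ z∈A)
          ...   | inj₂ z∈f rewrite x∈⁅y⁆⇒x≡y f z∈f = x∈p∪q⁺ (inj₂ f∈F)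
          X~B′ : Connected N r (X f) B′
          X~B′ = interval N (∣X∣≡r f∈F) ∣B′∣≡r (λ _ _ Z⊆ → ⊆U⇒nonbasis (X∪B′⊆U ∘′ Z⊆))

        found : ∀ {f} → f ∈ F → RankExchange B B′ (X f) (Y f) →
                ∃[ f ] (f ∈ B′ × f ∉ B × RankExchange B B′ (X f) (Y f))
        found {f} f∈F witness = f , f∈B′ f∈F , f∉B f∈F , witness

      rank-exchange : ∃[ f ] (f ∈ B′ × f ∉ B × RankExchange B B′ (exch B e f) (exch B′ f e))
      rank-exchange with e ∈? closure A
      rank-exchange | yes e∈clA with search (λ f → rk B′ ≤? rk (Y f)) F
      ... | inj₁ (f , f∈F , grows) = found f∈F (grow-when-spanned e∈clA grows)
      ... | inj₂ shrinks with ⊆⊎∃∉ F (closure A)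
      ...   | inj₂ (f , f∈F , f∉clA) = found f∈F (component-of-B e∈clA (ℕ.≰⇒> ∘′ shrinks) f∈F f∉clA)
      ...   | inj₁ F⊆clA = ⊥-elim (no-spanned-coloops F⊆clA coloops)
        where
        coloops : ∀ {f} → f ∈ F → rk (B′ - f) < rk B′
        coloops f∈F = ℕ.≤-<-trans (rankF-mono (p⊆p∪q ⁅ e ⁆)) (ℕ.≰⇒> (shrinks f∈F))
      rank-exchange | no e∉clA with search (λ f → rk B′ ≤? rk (Y f)) (F ─ closure A)
      ... | inj₁ (f , f∈G , grows) =
            let f∈F , f∉clA = x∈p─q⁻ F (closure A) f∈G in found f∈F (grow-when-free f∉clA grows)
      ... | inj₂ shrinks
        with free-forces-spanned e∉clA (ℕ.≰⇒> ∘′ shrinks) | search (λ f → rk B′ ≤? rk (B′ - f)) F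
      ...   | F⊆clA | inj₁ (f , f∈F , not-coloop) = found f∈F (component-of-B′ e∉clA F⊆clA f∈F not-coloop)
      ...   | F⊆clA | inj₂ coloops                = ⊥-elim (no-spanned-coloops F⊆clA (ℕ.≰⇒> ∘′ coloops))

    -- Reweighting ν_N on components

    deficiency : Subset n → ℕ
    deficiency X = r ∸ rk X

    νN≡deficiency : ∀ X → νN N r X ≡ fromℕ (deficiency X)
    νN≡deficiency X = fromℕ-∸ (rankF≤r X)

    deficiency-basis : ∀ {X} → isBasis N X ≡ true → deficiency X ≡ 0
    deficiency-basis X-basis = ℕ.m≤n⇒m∸n≡0 (basis⇒r≤rankF X-basis)

    deficiency-nonbasis : ∀ {X} → NonBasis N r X → 0 < deficiency X
    deficiency-nonbasis X-nb = ℕ.m<n⇒0<n∸m (nonbasis⇒rankF<r X-nb)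

    module _ (t : Subset n → ℕ) (t-constant : ∀ {X Y} → Connected N r X Y → t X ≡ t Y) where

      W : Subset n → ℕ
      W X = t X * deficiency X

      W≡t*deficiency : ∀ {X Z} → BasisOrConnected X Z → W X ≡ t Z * deficiency X
      W≡t*deficiency {X} {Z} X⇝Z with isBasis N X in X-basis?
      ... | true  rewrite deficiency-basis X-basis? = trans (ℕ.*-zeroʳ (t X)) (sym (ℕ.*-zeroʳ (t Z)))
      ... | false = cong (_* deficiency X) (t-constant (X⇝Z refl))

      W-mono-Adjacent : ∀ {X Y} → ∣ X ∣ ≡ r → ∣ Y ∣ ≡ r → Adjacent X Y → rk Y ≤ rk X → W X ≤ W Y
      W-mono-Adjacent {X} {Y} ∣X∣≡r ∣Y∣≡r adj rk-Y≤rk-X with isBasis N X in X-basis?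
      ... | true  rewrite deficiency-basis X-basis? | ℕ.*-zeroʳ (t X) = z≤n
      ... | false = subst (λ s → s * deficiency X ≤ W Y) (sym (t-constant X~Y))
                          (ℕ.*-monoʳ-≤ (t Y) (ℕ.∸-monoʳ-≤ r rk-Y≤rk-X))
        where
        Y-nonbasis : isBasis N Y ≡ false
        Y-nonbasis = rankF<r⇒nonbasis (ℕ.≤-<-trans rk-Y≤rk-X (nonbasis⇒rankF<r (∣X∣≡r , X-basis?)))
        X~Y : Connected N r X Y
        X~Y = step (∣X∣≡r , X-basis?) adj (here (∣Y∣≡r , Y-nonbasis))

      W-exchange : ∀ {B B′} → ∣ B ∣ ≡ r → ∣ B′ ∣ ≡ r → ∀ {e} → e ∈ B → e ∉ B′ →
                   ∃[ f ] (f ∈ B′ × f ∉ B × W (exch B e f) + W (exch B′ f e) ≤ W B + W B′)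
      W-exchange {B} {B′} ∣B∣≡r ∣B′∣≡r {e} e∈B e∉B′ with rank-exchange ∣B∣≡r ∣B′∣≡r e∈B e∉B′
      ... | f , f∈B′ , f∉B , both-grow rk-B≤ rk-B′≤ =
            f , f∈B′ , f∉B , ℕ.+-mono-≤ (W-exch≤W ∣B∣≡r e∈B f∉B rk-B≤) (W-exch≤W ∣B′∣≡r f∈B′ e∉B′ rk-B′≤)
        where
        W-exch≤W : ∀ {P a b} → ∣ P ∣ ≡ r → a ∈ P → b ∉ P → rk P ≤ rk (exch P a b) → W (exch P a b) ≤ W P
        W-exch≤W {P} ∣P∣≡r a∈P b∉P =
          W-mono-Adjacent (trans (∣exch∣≡∣p∣ P a∈P b∉P) ∣P∣≡r) ∣P∣≡r (exch-Adjacent a∈P b∉P)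
      ... | f , f∈B′ , f∉B , one-component ranks {Z} B⇝Z B′⇝Z X⇝Z Y⇝Z = f , f∈B′ , f∉B , (begin
            W X + W Y                                 ≡⟨ cong₂ _+_ (W≡t*deficiency X⇝Z) (W≡t*deficiency Y⇝Z) ⟩
            t Z * deficiency X + t Z * deficiency Y   ≡⟨ ℕ.*-distribˡ-+ (t Z) _ _ ⟨
            t Z * (deficiency X + deficiency Y)       ≤⟨ ℕ.*-monoʳ-≤ (t Z) deficiencies ⟩
            t Z * (deficiency B + deficiency B′)      ≡⟨ ℕ.*-distribˡ-+ (t Z) _ _ ⟩
            t Z * deficiency B + t Z * deficiency B′  ≡⟨ cong₂ _+_ (W≡t*deficiency B⇝Z) (W≡t*deficiency B′⇝Z) ⟨
            W B + W B′                                ∎)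
        where
        open ℕ.≤-Reasoning
        X = exch B e f
        Y = exch B′ f e
        deficiencies : deficiency X + deficiency Y ≤ deficiency B + deficiency B′
        deficiencies = ∸-exchange (rankF≤r B) (rankF≤r B′) (rankF≤r X) (rankF≤r Y) ranks

      reweighted-valuation : IsValuation r (fromℕ ∘′ W)
      reweighted-valuation B B′ ∣B∣≡r ∣B′∣≡r e e∈B e∉B′ with W-exchange ∣B∣≡r ∣B′∣≡r e∈B e∉B′
      ... | f , f∈B′ , f∉B , W-ineq = f , f∈B′ , f∉B ,
            subst₂ ℚ._≤_ (fromℕ-+ (W (exch B e f)) (W (exch B′ f e))) (fromℕ-+ (W B) (W B′)) (fromℕ-mono-≤ W-ineq)

      module _ (t-nonZero : ∀ X → NonZero (t X)) where

        private
          W≡0⇒deficiency≡0 : ∀ X → W X ≡ 0 → deficiency X ≡ 0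
          W≡0⇒deficiency≡0 X W≡0 with ℕ.m*n≡0⇒m≡0∨n≡0 (t X) W≡0
          ... | inj₁ t≡0 = contradiction t≡0 (ℕ.≢-nonZero⁻¹ (t X) {{t-nonZero X}})
          ... | inj₂ d≡0 = d≡0

          W-sum≡0⇔ : ∀ X Y → (W X + W Y ≡ 0) ⇔ (deficiency X + deficiency Y ≡ 0)
          W-sum≡0⇔ X Y = mk⇔
            (λ sum≡0 → cong₂ _+_ (W≡0⇒deficiency≡0 X (ℕ.m+n≡0⇒m≡0 (W X) sum≡0))
                                 (W≡0⇒deficiency≡0 Y (ℕ.m+n≡0⇒n≡0 (W X) sum≡0)))
            (λ sum≡0 → cong₂ _+_ (trans (cong (t X *_) (ℕ.m+n≡0⇒m≡0 (deficiency X) sum≡0)) (ℕ.*-zeroʳ (t X)))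
                                 (trans (cong (t Y *_) (ℕ.m+n≡0⇒n≡0 (deficiency X) sum≡0)) (ℕ.*-zeroʳ (t Y))))

          bases-bracket : ∀ {X Y} → isBasis N X ≡ true → isBasis N Y ≡ true → ∀ U V →
                          (W U + W V ≡ W X + W Y) ⇔ (deficiency U + deficiency V ≡ deficiency X + deficiency Y)
          bases-bracket {X} {Y} X-basis Y-basis U V = mk⇔
            (λ eq → trans (Equivalence.to (W-sum≡0⇔ U V) (trans eq W-zero)) (sym deficiency-zero))
            (λ eq → trans (Equivalence.from (W-sum≡0⇔ U V) (trans eq deficiency-zero)) (sym W-zero))
            where
            deficiency-zero : deficiency X + deficiency Y ≡ 0
            deficiency-zero = cong₂ _+_ (deficiency-basis X-basis) (deficiency-basis Y-basis)
            W-zero : W X + W Y ≡ 0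
            W-zero = Equivalence.from (W-sum≡0⇔ X Y) deficiency-zero

          common-bracket : ∀ {Z P₁ P₂ P₃ P₄} →
                           BasisOrConnected P₁ Z → BasisOrConnected P₂ Z →
                           BasisOrConnected P₃ Z → BasisOrConnected P₄ Z →
                           (W P₁ + W P₂ ≡ W P₃ + W P₄) ⇔
                           (deficiency P₁ + deficiency P₂ ≡ deficiency P₃ + deficiency P₄)
          common-bracket {Z} P₁⇝Z P₂⇝Z P₃⇝Z P₄⇝Z = mk⇔
            (λ eq → ℕ.*-cancelˡ-≡ _ _ (t Z) {{t-nonZero Z}} (trans (sym scaled₁₂) (trans eq scaled₃₄)))
            (λ eq → trans scaled₁₂ (trans (cong (t Z *_) eq) (sym scaled₃₄)))
            where
            scaled₁₂ = trans (cong₂ _+_ (W≡t*deficiency P₁⇝Z) (W≡t*deficiency P₂⇝Z)) (sym (ℕ.*-distribˡ-+ (t Z) _ _))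
            scaled₃₄ = trans (cong₂ _+_ (W≡t*deficiency P₃⇝Z) (W≡t*deficiency P₄⇝Z)) (sym (ℕ.*-distribˡ-+ (t Z) _ _))

          swap-sides : ∀ {a b c d : ℕ} → (a ≡ b) ⇔ (c ≡ d) → (b ≡ a) ⇔ (d ≡ c)
          swap-sides a≡b⇔c≡d =
            mk⇔ (sym ∘′ Equivalence.to a≡b⇔c≡d ∘′ sym) (sym ∘′ Equivalence.from a≡b⇔c≡d ∘′ sym)

        -- P and Q are the two diagonals of a 4-cycle of r-sets in the Johnson graph.  Unless one
        -- diagonal consists of bases, all non-bases among the four sets lie in one component.
        module _ (P Q : Bool → Subset n) (∣P∣≡r : ∀ i → ∣ P i ∣ ≡ r) (∣Q∣≡r : ∀ j → ∣ Q j ∣ ≡ r)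
                 (adjacent : ∀ i j → Adjacent (P i) (Q j)) where

          private
            through : ∀ i j → isBasis N (P i) ≡ false → isBasis N (Q j) ≡ false →
                      Balanced P Q W ⇔ Balanced P Q deficiency
            through i j Pᵢ-nonbasis Qⱼ-nonbasis = common-bracket (P⇝ false) (P⇝ true) (Q⇝ false) (Q⇝ true)
              where
              Pᵢ-nb : NonBasis N r (P i)
              Pᵢ-nb = ∣P∣≡r i , Pᵢ-nonbasis
              adjacent′ : ∀ j′ → Adjacent (Q j′) (P i)
              adjacent′ j′ = Adjacent-sym {X = P i} (trans (∣P∣≡r i) (sym (∣Q∣≡r j′))) (adjacent i j′)
              P⇝ : ∀ i′ → BasisOrConnected (P i′) (P i)
              P⇝ i′ nb = step (∣P∣≡r i′ , nb) (adjacent i′ j)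
                              (step (∣Q∣≡r j , Qⱼ-nonbasis) (adjacent′ j) (here Pᵢ-nb))
              Q⇝ : ∀ j′ → BasisOrConnected (Q j′) (P i)
              Q⇝ j′ nb = step (∣Q∣≡r j′ , nb) (adjacent′ j′) (here Pᵢ-nb)

          W-bracket : Balanced P Q W ⇔ Balanced P Q deficiency
          W-bracket with isBasis N (P false) in P₀? | isBasis N (P true) in P₁?
                       | isBasis N (Q false) in Q₀? | isBasis N (Q true) in Q₁?
          ... | _     | _     | true  | true  = bases-bracket Q₀? Q₁? (P false) (P true)
          ... | true  | true  | _     | _     = swap-sides (bases-bracket P₀? P₁? (Q false) (Q true))
          ... | false | _     | false | _     = through false false P₀? Q₀?
          ... | false | _     | true  | false = through false true  P₀? Q₁?
          ... | true  | false | false | _     = through true  false P₁? Q₀?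
          ... | true  | false | true  | false = through true  true  P₁? Q₁?

        reweighted-bracket : SameBracket r (νN N r) (fromℕ ∘′ W)
        reweighted-bracket S a b c d
          (∣S∣+2≡r , (a∉S , b∉S , c∉S , d∉S) , (a≢b , a≢c , a≢d , b≢c , b≢d , c≢d)) =
          as-ℕ W ⟨⇔⟩ W-bracket P Q ∣P∣≡r ∣Q∣≡r adjacent ⟨⇔⟩ ⇔.sym (as-ℕ deficiency) ⟨⇔⟩
          InBracket-cong {ν = fromℕ ∘′ deficiency} {νN N r} (λ X → sym (νN≡deficiency X)) S a b c d
          where
          _⟨⇔⟩_ = ⇔.trans
          infixr 5 _⟨⇔⟩_
          P Q : Bool → Subset n
          P false = S +₂ a , c
          P true  = S +₂ b , d
          Q false = S +₂ a , d
          Q true  = S +₂ b , c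
          ∣P∣≡r : ∀ i → ∣ P i ∣ ≡ r
          ∣P∣≡r false = trans (∣+₂∣≡2+∣S∣ a∉S c∉S a≢c) ∣S∣+2≡r
          ∣P∣≡r true  = trans (∣+₂∣≡2+∣S∣ b∉S d∉S b≢d) ∣S∣+2≡r
          ∣Q∣≡r : ∀ j → ∣ Q j ∣ ≡ r
          ∣Q∣≡r false = trans (∣+₂∣≡2+∣S∣ a∉S d∉S a≢d) ∣S∣+2≡r
          ∣Q∣≡r true  = trans (∣+₂∣≡2+∣S∣ b∉S c∉S b≢c) ∣S∣+2≡r
          adjacent : ∀ i j → Adjacent (P i) (Q j)
          adjacent false false = Adjacent-+₂ c∉S (a≢c ∘′ sym) c≢d
          adjacent false true  = subst₂ Adjacent (+₂-comm S c a) (+₂-comm S c b) (Adjacent-+₂ a∉S a≢c a≢b)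
          adjacent true  false = subst₂ Adjacent (+₂-comm S d b) (+₂-comm S d a) (Adjacent-+₂ b∉S b≢d (a≢b ∘′ sym))
          adjacent true  true  = Adjacent-+₂ d∉S (b≢d ∘′ sym) (c≢d ∘′ sym)
          as-ℕ : (f : Subset n → ℕ) → InBracket (fromℕ ∘′ f) S a b c d ⇔ Balanced P Q f
          as-ℕ f = fromℕ-sum-≡⇔ (f (P false)) (f (P true)) (f (Q false)) (f (Q true))

        reweighted-∈D : InD r (νN N r) (fromℕ ∘′ W)
        reweighted-∈D = reweighted-valuation , reweighted-bracket

    -- Affinely independent points of D(ν_N)

    module Components {c} (R : Fin c → Subset n) (R-nonbasis : ∀ i → NonBasis N r (R i))
                      (R-distinct : ∀ i j → Connected N r (R i) (R j) → i ≡ j)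
                      (R-cover : ∀ X → NonBasis N r X → ∃[ i ] Connected N r X (R i)) where

      componentOf : Subset n → Maybe (Fin c)
      componentOf X with (∣ X ∣ ℕ.≟ r) ×-dec (isBasis N X Bool.≟ false)
      ... | yes X-nb = just (proj₁ (R-cover X X-nb))
      ... | no _     = nothing

      componentOf-nonbasis : ∀ {X} → NonBasis N r X → ∃[ i ] (componentOf X ≡ just i × Connected N r X (R i))
      componentOf-nonbasis {X} X-nb with (∣ X ∣ ℕ.≟ r) ×-dec (isBasis N X Bool.≟ false)
      ... | yes X-nb′ = proj₁ (R-cover X X-nb′) , refl , proj₂ (R-cover X X-nb′)
      ... | no ¬X-nb  = contradiction X-nb ¬X-nb

      componentOf-Connected : ∀ {X Y} → Connected N r X Y → componentOf X ≡ componentOf Y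
      componentOf-Connected X~Y
        with componentOf-nonbasis (Connected⇒NonBasisˡ N X~Y)
           | componentOf-nonbasis (Connected⇒NonBasisʳ N X~Y)
      ... | i , X↦i , X~Rᵢ | j , Y↦j , Y~Rⱼ = trans X↦i (trans (cong just i≡j) (sym Y↦j))
        where
        i≡j : i ≡ j
        i≡j = R-distinct i j (Connected-trans N (Connected-sym N X~Rᵢ) (Connected-trans N X~Y Y~Rⱼ))

      componentOf-R : ∀ i → componentOf (R i) ≡ just i
      componentOf-R i with componentOf-nonbasis (R-nonbasis i)
      ... | j , Rᵢ↦j , Rᵢ~Rⱼ = trans Rᵢ↦j (cong just (sym (R-distinct i j Rᵢ~Rⱼ)))

      indicator : Maybe (Fin c) → Fin c → ℕ
      indicator nothing  i = 0
      indicator (just j) i = if does (j Fin.≟ i) then 1 else 0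

      indicator-≢ : ∀ {i j} → j ≢ i → indicator (just j) i ≡ 0
      indicator-≢ {i} {j} j≢i with j Fin.≟ i
      ... | yes j≡i = contradiction j≡i j≢i
      ... | no _    = refl

      indicator-≡ : ∀ i → indicator (just i) i ≡ 1
      indicator-≡ i with i Fin.≟ i
      ... | yes _  = refl
      ... | no i≢i = contradiction refl i≢i

      weight : Fin (suc c) → Subset n → ℕ
      weight Fin.zero    X = 1
      weight (Fin.suc i) X = suc (indicator (componentOf X) i)

      weight-constant : ∀ k {X Y} → Connected N r X Y → weight k X ≡ weight k Y
      weight-constant Fin.zero    X~Y = refl
      weight-constant (Fin.suc i) X~Y = cong (λ C → suc (indicator C i)) (componentOf-Connected X~Y)

      weight-nonZero : ∀ k X → NonZero (weight k X)
      weight-nonZero Fin.zero    X = _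
      weight-nonZero (Fin.suc i) X = _

      points : Fin (suc c) → Subset n → ℚ
      points k X = fromℕ (weight k X * deficiency X)

      points-∈D : ∀ k → InD r (νN N r) (points k)
      points-∈D k = reweighted-∈D (weight k) (weight-constant k) (weight-nonZero k)

      points-affinely-independent : AffinelyIndependent r c points
      points-affinely-independent λs vanish i₀ =
        *-fromℕ≡0 (λs i₀) (deficiency X) (deficiency-nonbasis (R-nonbasis i₀)) (begin
          λs i₀ ℚ.* fromℕ (deficiency X)  ≡⟨ term-i₀ ⟨
          term i₀                         ≡⟨ sumFin-single c term i₀ term-vanishes ⟨
          sumFin c term                   ≡⟨ vanish X (proj₁ (R-nonbasis i₀)) ⟩
          0ℚ                              ∎)
        where
        open ≡-Reasoning
        X = R i₀
        d = deficiency X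
        term : Fin c → ℚ
        term i = λs i ℚ.* (points (Fin.suc i) X ℚ.- points Fin.zero X)
        term≡ : ∀ i → term i ≡ λs i ℚ.* fromℕ (indicator (just i₀) i * d)
        term≡ i = cong (λs i ℚ.*_) (begin
          fromℕ (d + indicator (componentOf X) i * d) ℚ.- fromℕ (1 * d)
            ≡⟨ cong₂ (λ C e → fromℕ (d + indicator C i * d) ℚ.- fromℕ e) (componentOf-R i₀) (ℕ.*-identityˡ d) ⟩
          fromℕ (d + indicator (just i₀) i * d) ℚ.- fromℕ d
            ≡⟨ fromℕ-+-cancelˡ d _ ⟩
          fromℕ (indicator (just i₀) i * d)
            ∎)
        term-vanishes : ∀ i → i ≢ i₀ → term i ≡ 0ℚ
        term-vanishes i i≢i₀ = begin
          term i                                      ≡⟨ term≡ i ⟩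
          λs i ℚ.* fromℕ (indicator (just i₀) i * d)  ≡⟨ cong (λ m → λs i ℚ.* fromℕ (m * d)) (indicator-≢ (i≢i₀ ∘′ sym)) ⟩
          λs i ℚ.* 0ℚ                                 ≡⟨ ℚ.*-zeroʳ (λs i) ⟩
          0ℚ                                          ∎
        term-i₀ : term i₀ ≡ λs i₀ ℚ.* fromℕ d
        term-i₀ = begin
          term i₀                                       ≡⟨ term≡ i₀ ⟩
          λs i₀ ℚ.* fromℕ (indicator (just i₀) i₀ * d)  ≡⟨ cong (λ m → λs i₀ ℚ.* fromℕ (m * d)) (indicator-≡ i₀) ⟩
          λs i₀ ℚ.* fromℕ (1 * d)                       ≡⟨ cong (λ m → λs i₀ ℚ.* fromℕ m) (ℕ.*-identityˡ d) ⟩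
          λs i₀ ℚ.* fromℕ d                             ∎

lemma13 : ∀ (n : ℕ) (N : Matroid n) (r : ℕ) → HasRank N r →
          ∀ (c : ℕ) → NumComponents N r c →
          DimD≥ r (νN N r) c
lemma13 n N r hasRank c (R , R-nonbasis , R-distinct , R-cover) =
  points , points-∈D , points-affinely-independent
  where open Components N hasRank R R-nonbasis R-distinct R-cover
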